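{- For all sufficiently large $k$ the following holds. Let $\sigma\in[k]^n$ with $n<(1+e^{ -600})k^2/e$, and for each symbol $m\in[k]$ let $a_m$ be the number of occurrences of $m$ in $\sigma$. Then either $\sigma$ contains at most $\exp(-e^{ -600}k)\,k!$ distinct patterns $\pi\in S_k$, or at least $0.99k$ symbols $m\in[k]$ are common, i.e.\ satisfy $a_m>0.1k$.
   Context: $[k]=\{1,\dots,k\}$. A sequence $\sigma\in[k]^n$ contains $\pi\in S_k$ if there are indices $t_1<\dots<t_k$ with $\sigma(t_i)<\sigma(t_j)$ if and only if $\pi(i)<\pi(j)$. -}

module Defs where

open import Data.Nat as ℕ using (ℕ; zero; suc; _*_; _!)
open import Data.Integer using (+_)
open import Data.Fin as Fin using (Fin)
open import Data.Vec using (Vec; lookup; toList)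
open import Data.List using (List; length; filter; allFin)
open import Data.Product using (Σ; ∃; _×_)
open import Function.Bundles using (_⇔_)
open import Function.Definitions using (Injective)
open import Relation.Binary.PropositionalEquality using (_≡_)
open import Data.Rational as Q using (ℚ; 0ℚ; 1ℚ)

-- A permutation π ∈ S_k, given by its one-line notation (π(1),…,π(k)).
IsPerm : {k : ℕ} → Vec (Fin k) k → Set
IsPerm π = Injective _≡_ _≡_ (lookup π)

Contains : {k n : ℕ} → Vec (Fin k) n → Vec (Fin k) k → Set
Contains {k} {n} σ π =
  Σ (Fin k → Fin n) λ t →
    ((i j : Fin k) → i Fin.< j → t i Fin.< t j) ×
    ((i j : Fin k) → (lookup σ (t i) Fin.< lookup σ (t j)) ⇔ (lookup π i Fin.< lookup π j))

occ : {k n : ℕ} → Vec (Fin k) n → Fin k → ℕ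
occ σ m = length (filter (Fin._≟ m) (toList σ))

-- number of common symbols: m ∈ [k] with a_m > 0.1 k, i.e. 10 a_m > k
numCommon : {k n : ℕ} → Vec (Fin k) n → ℕ
numCommon {k} σ = length (filter (λ m → k ℕ.<? 10 * occ σ m) (allFin k))

-- Exact real constants via the exponential series (no reals in stdlib)

ℕtoℚ : ℕ → ℚ
ℕtoℚ m = (+ m) Q./ 1

expTerm : ℚ → ℕ → ℚ
expTerm x zero = 1ℚ
expTerm x (suc i) = expTerm x i Q.* x Q.* ((+ 1) Q./ suc i)

-- expSum x N = Σ_{i=0}^{N} x^i / i!   (increases to exp x for x ≥ 0)
expSum : ℚ → ℕ → ℚ
expSum x zero = 1ℚ
expSum x (suc N) = expSum x N Q.+ expTerm x (suc N)

-- Hypothesis  n < (1 + e^{-600}) k² / e,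
-- equivalently  n·e^{601} < (e^{600} + 1)·k²,
-- stated as: some rational q with n·e^{601} ≤ q < (e^{600}+1)·k².
LengthBound : ℕ → ℕ → Set
LengthBound n k =
  Σ ℚ λ q →
    ((N : ℕ) → ℕtoℚ n Q.* expSum (ℕtoℚ 601) N Q.≤ q) ×
    (∃ λ N → q Q.< (expSum (ℕtoℚ 600) N Q.+ 1ℚ) Q.* ℕtoℚ (k * k))

-- r < e^{-600}·k  (for r ≥ 0), i.e. r·e^{600} < k
BelowDeltaK : ℚ → ℕ → Set
BelowDeltaK r k =
  Σ ℚ λ q → (q Q.< ℕtoℚ k) × ((N : ℕ) → r Q.* expSum (ℕtoℚ 600) N Q.≤ q)

-- P ≤ exp(-e^{-600} k)·k!, i.e. P·exp(e^{-600} k) ≤ k!,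
-- stated as: P·exp(r) ≤ k! for every rational 0 ≤ r < e^{-600} k
-- (equivalent by monotonicity and continuity of exp).
AtMostPatternBound : ℕ → ℕ → Set
AtMostPatternBound P k =
  (r : ℚ) → 0ℚ Q.≤ r → BelowDeltaK r k →
  (M : ℕ) → ℕtoℚ P Q.* expSum r M Q.≤ ℕtoℚ (k !)

-- σ contains at most exp(-e^{-600} k)·k! distinct patterns π ∈ S_k:
-- every list of distinct patterns contained in σ has admissible length.
open import Data.List.Relation.Unary.All using (All)
open import Data.List.Relation.Unary.Unique.Propositional using (Unique)

FewPatterns : {k n : ℕ} → Vec (Fin k) n → Set
FewPatterns {k} σ =
  (L : List (Vec (Fin k) k)) → Unique L →
  All (λ π → IsPerm π × Contains σ π) L →
  AtMostPatternBound (length L) k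

-- A pattern contained in σ is determined by its occurrence, a subsequence of σ that lists
-- every symbol exactly once; hence σ contains at most Π_m a_m patterns.  Suppose fewer than
-- 0.99k symbols are common, so that d ≥ k/100 symbols are rare.  AM-GM over the c common
-- symbols and a_m ≤ k/10 for the rare ones give Π_m a_m ≤ (n/c)^c (k/10)^d.  With
-- n < (1 + e^{-600}) k²/e, k! ≥ (k/e)^k and (k/c)^c = (1 + d/c)^c ≤ e^d this is at most
-- (1 + e^{-600})^c (e²/10)^d k!, and (e²/10)^{k/100} is far below exp(-e^{-600} k).
-- Everything is computed in ℕ, using 163/60 ≤ e ≤ 68/25 and e^{600} > 3·10⁷.

module Submission where

open import Defs

module PowerBounds where
  open import Data.Nat
  open import Data.Nat.Properties
  open import Data.Product using (_,_)
  open import Data.Sum using (inj₁; inj₂)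
  open import Data.List using (List; []; _∷_; length)
  open import Data.Nat.ListAction using (sum; product)
  open import Relation.Binary.PropositionalEquality
  open import Data.Nat.Tactic.RingSolver
  open import Algebra.Properties.CommutativeSemigroup *-commutativeSemigroup
    using (interchange; xy∙z≈xz∙y)

  ^-distribʳ-* : ∀ a b n → (a * b) ^ n ≡ a ^ n * b ^ n
  ^-distribʳ-* a b zero = refl
  ^-distribʳ-* a b (suc n) rewrite ^-distribʳ-* a b n = interchange a b (a ^ n) (b ^ n)

  +-^-lowerBound : ∀ v u n → v ^ suc n + suc n * u * v ^ n ≤ (v + u) ^ suc n
  +-^-lowerBound v u zero = ≤-reflexive (base v u)
    where base : ∀ v u → v * 1 + 1 * u * 1 ≡ (v + u) * 1
          base = solve-∀
  +-^-lowerBound v u (suc n) = begin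
      v * (v * X) + suc (suc n) * u * (v * X)
        ≤⟨ m≤m+n _ _ ⟩
      v * (v * X) + suc (suc n) * u * (v * X) + suc n * u * u * X
        ≡⟨ expand v u n X ⟩
      (v + u) * (v * X + suc n * u * X)
        ≤⟨ *-monoʳ-≤ (v + u) (+-^-lowerBound v u n) ⟩
      (v + u) * (v + u) ^ suc n ∎
    where
      open ≤-Reasoning
      X = v ^ n
      expand : ∀ v u n X → v * (v * X) + suc (suc n) * u * (v * X) + suc n * u * u * X
                         ≡ (v + u) * (v * X + suc n * u * X)
      expand = solve-∀

  +-^-upperBound : ∀ w u n → (w + u) ^ suc n ≤ w ^ suc n + suc n * u * (w + u) ^ n
  +-^-upperBound w u zero = ≤-reflexive (base w u)
    where base : ∀ w u → (w + u) * 1 ≡ w * 1 + 1 * u * 1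
          base = solve-∀
  +-^-upperBound w u (suc n) = begin
      (w + u) * ((w + u) * X)
        ≡⟨ *-distribʳ-+ ((w + u) * X) w u ⟩
      w * ((w + u) * X) + u * ((w + u) * X)
        ≤⟨ +-monoˡ-≤ _ (*-monoʳ-≤ w (+-^-upperBound w u n)) ⟩
      w * (Y + suc n * u * X) + u * ((w + u) * X)
        ≡⟨ distribute w u n X Y ⟩
      w * Y + suc n * u * (w * X) + u * ((w + u) * X)
        ≤⟨ +-monoˡ-≤ _ (+-monoʳ-≤ (w * Y) (*-monoʳ-≤ (suc n * u) (*-monoˡ-≤ X (m≤m+n w u)))) ⟩
      w * Y + suc n * u * ((w + u) * X) + u * ((w + u) * X)
        ≡⟨ collect w u n X Y ⟩
      w * Y + suc (suc n) * u * ((w + u) * X) ∎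
    where
      open ≤-Reasoning
      X = (w + u) ^ n
      Y = w ^ suc n
      distribute : ∀ w u n X Y → w * (Y + suc n * u * X) + u * ((w + u) * X)
                               ≡ w * Y + suc n * u * (w * X) + u * ((w + u) * X)
      distribute = solve-∀
      collect : ∀ w u n X Y → w * Y + suc n * u * ((w + u) * X) + u * ((w + u) * X)
                            ≡ w * Y + suc (suc n) * u * ((w + u) * X)
      collect = solve-∀

  -- The inductive step of AM-GM, a (S/m)^m ≤ ((S + a)/(m + 1))^(m+1).  With u = ±(m a − S)
  -- it is the lower (resp. upper) binomial bound at v = (m + 1) S (resp. w = m (S + a)).
  amgm-step-≤ : ∀ m S a u → .{{NonZero m}} → S + u ≡ m * a →
                suc m ^ suc m * S ^ m * a ≤ m ^ m * (S + a) ^ suc m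
  amgm-step-≤ m S a u e = *-cancelˡ-≤ m (begin
      m * (suc m * Pm * Sm * a) ≡⟨ reorder m Pm Sm a ⟩
      suc m * Pm * Sm * (m * a) ≡⟨ cong (suc m * Pm * Sm *_) (sym e) ⟩
      suc m * Pm * Sm * (S + u) ≡⟨ expand m Pm Sm S u ⟩
      v * (Pm * Sm) + suc m * u * (Pm * Sm) ≡⟨ cong (λ z → v * z + suc m * u * z) (sym (^-distribʳ-* (suc m) S m)) ⟩
      v ^ suc m + suc m * u * v ^ m ≤⟨ +-^-lowerBound v u m ⟩
      (v + u) ^ suc m ≡⟨ cong (_^ suc m) v+u≡m[S+a] ⟩
      (m * (S + a)) ^ suc m ≡⟨ ^-distribʳ-* m (S + a) (suc m) ⟩
      m * m ^ m * (S + a) ^ suc m ≡⟨ *-assoc m (m ^ m) _ ⟩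
      m * (m ^ m * (S + a) ^ suc m) ∎)
    where
      open ≤-Reasoning
      v = suc m * S
      Pm = suc m ^ m
      Sm = S ^ m
      v+u≡m[S+a] : v + u ≡ m * (S + a)
      v+u≡m[S+a] = begin-equality
        suc m * S + u  ≡⟨ +-assoc S (m * S) u ⟩
        S + (m * S + u) ≡⟨ cong (S +_) (+-comm (m * S) u) ⟩
        S + (u + m * S) ≡⟨ sym (+-assoc S u (m * S)) ⟩
        S + u + m * S ≡⟨ cong (_+ m * S) e ⟩
        m * a + m * S ≡⟨ +-comm (m * a) (m * S) ⟩
        m * S + m * a ≡⟨ *-distribˡ-+ m S a ⟨
        m * (S + a) ∎
      reorder : ∀ m P Q a → m * (suc m * P * Q * a) ≡ suc m * P * Q * (m * a)
      reorder = solve-∀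
      expand : ∀ m P Q S u → suc m * P * Q * (S + u) ≡ suc m * S * (P * Q) + suc m * u * (P * Q)
      expand = solve-∀

  amgm-step-≥ : ∀ m S a u → .{{NonZero m}} → m * a + u ≡ S →
                suc m ^ suc m * S ^ m * a ≤ m ^ m * (S + a) ^ suc m
  amgm-step-≥ m S a u e = *-cancelˡ-≤ m (+-cancelʳ-≤ X _ _ (begin
      m * (suc m * Pm * Sm * a) + X ≡⟨ collect m Pm Sm a u ⟩
      suc m * (m * a + u) * (Pm * Sm) ≡⟨ cong (λ z → suc m * z * (Pm * Sm)) e ⟩
      suc m * S * (Pm * Sm) ≡⟨ cong₂ _*_ (sym w+u≡[1+m]S) (sym [w+u]^m) ⟩
      (w + u) ^ suc m ≤⟨ +-^-upperBound w u m ⟩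
      w ^ suc m + suc m * u * (w + u) ^ m
        ≡⟨ cong₂ (λ p q → p + suc m * u * q) (^-distribʳ-* m (S + a) (suc m)) [w+u]^m ⟩
      m * m ^ m * (S + a) ^ suc m + X ≡⟨ cong (_+ X) (*-assoc m (m ^ m) _) ⟩
      m * (m ^ m * (S + a) ^ suc m) + X ∎))
    where
      open ≤-Reasoning
      w = m * (S + a)
      Pm = suc m ^ m
      Sm = S ^ m
      w+u≡[1+m]S : w + u ≡ suc m * S
      w+u≡[1+m]S = begin-equality
        m * (S + a) + u ≡⟨ cong (_+ u) (*-distribˡ-+ m S a) ⟩
        m * S + m * a + u ≡⟨ +-assoc (m * S) (m * a) u ⟩
        m * S + (m * a + u) ≡⟨ cong (m * S +_) e ⟩
        m * S + S ≡⟨ +-comm (m * S) S ⟩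
        suc m * S ∎
      [w+u]^m : (w + u) ^ m ≡ Pm * Sm
      [w+u]^m = trans (cong (_^ m) w+u≡[1+m]S) (^-distribʳ-* (suc m) S m)
      X = suc m * u * (Pm * Sm)
      collect : ∀ m P Q a u → m * (suc m * P * Q * a) + suc m * u * (P * Q) ≡ suc m * (m * a + u) * (P * Q)
      collect = solve-∀

  amgm-step : ∀ m S a → .{{NonZero m}} → suc m ^ suc m * S ^ m * a ≤ m ^ m * (S + a) ^ suc m
  amgm-step m S a with ≤-total S (m * a)
  ... | inj₁ S≤ma = let (u , e) = m≤n⇒∃[o]m+o≡n S≤ma in amgm-step-≤ m S a u e
  ... | inj₂ ma≤S = let (u , e) = m≤n⇒∃[o]m+o≡n ma≤S in amgm-step-≥ m S a u e

  amgm : ∀ xs → length xs ^ length xs * product xs ≤ sum xs ^ length xs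
  amgm [] = ≤-refl
  amgm (x ∷ []) = ≤-reflexive (base x)
    where base : ∀ x → 1 * (x * 1) ≡ (x + 0) * 1
          base = solve-∀
  amgm (x ∷ ys@(_ ∷ _)) = *-cancelˡ-≤ (m ^ m) {{m^n≢0 m m}} (begin
      m ^ m * (suc m ^ suc m * (x * Π)) ≡⟨ reorder (m ^ m) (suc m ^ suc m) x Π ⟩
      suc m ^ suc m * x * (m ^ m * Π) ≤⟨ *-monoʳ-≤ (suc m ^ suc m * x) (amgm ys) ⟩
      suc m ^ suc m * x * S ^ m ≡⟨ xy∙z≈xz∙y (suc m ^ suc m) x (S ^ m) ⟩
      suc m ^ suc m * S ^ m * x ≤⟨ amgm-step m S x ⟩
      m ^ m * (S + x) ^ suc m ≡⟨ cong (λ z → m ^ m * z ^ suc m) (+-comm S x) ⟩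
      m ^ m * (x + S) ^ suc m ∎)
    where
      open ≤-Reasoning
      m = length ys
      S = sum ys
      Π = product ys
      reorder : ∀ a b x p → a * (b * (x * p)) ≡ b * x * (a * p)
      reorder = solve-∀

module EulerBounds where
  open import Data.Nat
  open import Data.Nat.Properties
  open import Data.Product using (_×_; _,_; proj₂)
  open import Data.Sum using (inj₁; inj₂)
  open import Relation.Binary.PropositionalEquality
  open import Relation.Nullary.Decidable using (toWitness)
  open import Data.Nat.Tactic.RingSolver
  open import Algebra.Properties.CommutativeSemigroup *-commutativeSemigroup
    using (x∙yz≈y∙xz; x∙yz≈xz∙y; xy∙z≈xz∙y)
  open PowerBounds

  _≼_ : ℕ × ℕ → ℕ × ℕ → Set
  (p , q) ≼ (p′ , q′) = p * q′ ≤ p′ * q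

  ≼-refl : ∀ {x} → x ≼ x
  ≼-refl {p , q} = ≤-refl

  ≼-trans : ∀ x y z → .{{NonZero (proj₂ y)}} → x ≼ y → y ≼ z → x ≼ z
  ≼-trans (p , q) (p′ , q′) (p″ , q″) x≼y y≼z = *-cancelʳ-≤ _ _ q′ (begin
    p * q″ * q′ ≡⟨ xy∙z≈xz∙y p q″ q′ ⟩
    p * q′ * q″ ≤⟨ *-monoˡ-≤ q″ x≼y ⟩
    p′ * q * q″ ≡⟨ xy∙z≈xz∙y p′ q q″ ⟩
    p′ * q″ * q ≤⟨ *-monoˡ-≤ q y≼z ⟩
    p″ * q′ * q ≡⟨ xy∙z≈xz∙y p″ q′ q ⟩
    p″ * q * q′ ∎)
    where open ≤-Reasoning

  -- (1 + 1/c)^c and (1 + 1/c)^(c+1), which squeeze e.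
  e⁻ e⁺ : ℕ → ℕ × ℕ
  e⁻ c = (suc c ^ c , c ^ c)
  e⁺ c = (suc c ^ suc c , c ^ suc c)

  c^c≢0 : ∀ c → NonZero (c ^ c)
  c^c≢0 zero = _
  c^c≢0 (suc c) = m^n≢0 (suc c) (suc c)

  c*[2+c]+1≡[1+c]² : ∀ c → c * suc (suc c) + 1 ≡ suc c * suc c
  c*[2+c]+1≡[1+c]² = solve-∀

  e⁻-step : ∀ c → .{{NonZero c}} → e⁻ c ≼ e⁻ (suc c)
  e⁻-step c = *-cancelˡ-≤ c (+-cancelʳ-≤ (c1 * (Q * Q)) _ _ (begin
      c * (Q * (c1 * Q)) + c1 * (Q * Q) ≡⟨ collect c Q ⟩
      (c1 * c1) * (Q * Q) ≡⟨ cong₂ _*_ (sym (c*[2+c]+1≡[1+c]² c)) (sym [w+1]^c) ⟩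
      (w + 1) ^ suc c ≤⟨ +-^-upperBound w 1 c ⟩
      w ^ suc c + suc c * 1 * (w + 1) ^ c
        ≡⟨ cong₂ (λ p q → p + suc c * 1 * q) (^-distribʳ-* c (suc c1) (suc c)) [w+1]^c ⟩
      c * c ^ c * (suc c1 ^ suc c) + suc c * 1 * (Q * Q) ≡⟨ reorder c (c ^ c) (suc c1 ^ suc c) (Q * Q) ⟩
      c * (suc c1 ^ suc c * c ^ c) + c1 * (Q * Q) ∎))
    where
      open ≤-Reasoning
      c1 = suc c
      w = c * suc c1
      Q = c1 ^ c
      [w+1]^c : (w + 1) ^ c ≡ Q * Q
      [w+1]^c = trans (cong (_^ c) (c*[2+c]+1≡[1+c]² c)) (^-distribʳ-* c1 c1 c)
      collect : ∀ c Q → c * (Q * (suc c * Q)) + suc c * (Q * Q) ≡ (suc c * suc c) * (Q * Q)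
      collect = solve-∀
      reorder : ∀ c x y z → c * x * y + suc c * 1 * z ≡ c * (y * x) + suc c * z
      reorder = solve-∀

  e⁺-step : ∀ c → e⁺ (suc c) ≼ e⁺ c
  e⁺-step c = *-cancelˡ-≤ c1 (begin
      c1 * (suc c1 ^ suc c1 * c ^ suc c)
        ≡⟨ expand c (suc c1 ^ suc c) (c ^ suc c) ⟩
      v * (c ^ suc c * suc c1 ^ suc c) + suc c1 * 1 * (c ^ suc c * suc c1 ^ suc c)
        ≡⟨ cong (λ z → v * z + suc c1 * 1 * z) (sym (^-distribʳ-* c (suc c1) (suc c))) ⟩
      v ^ suc c1 + suc c1 * 1 * v ^ suc c ≤⟨ +-^-lowerBound v 1 c1 ⟩
      (v + 1) ^ suc c1 ≡⟨ cong (_^ suc c1) (c*[2+c]+1≡[1+c]² c) ⟩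
      (c1 * c1) ^ suc c1 ≡⟨ ^-distribʳ-* c1 c1 (suc c1) ⟩
      c1 ^ suc c1 * c1 ^ suc c1 ≡⟨ *-assoc c1 (c1 ^ suc c) _ ⟩
      c1 * (c1 ^ suc c * c1 ^ suc c1) ∎)
    where
      open ≤-Reasoning
      c1 = suc c
      v = c * suc c1
      expand : ∀ c x y → suc c * (suc (suc c) * x * y)
                       ≡ (c * suc (suc c)) * (y * x) + suc (suc c) * 1 * (y * x)
      expand = solve-∀

  e⁻≼e⁺ : ∀ c → e⁻ c ≼ e⁺ c
  e⁻≼e⁺ c = begin
    suc c ^ c * (c * c ^ c) ≡⟨ x∙yz≈y∙xz (suc c ^ c) c (c ^ c) ⟩
    c * (suc c ^ c * c ^ c) ≤⟨ *-monoˡ-≤ (suc c ^ c * c ^ c) (n≤1+n c) ⟩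
    suc c * (suc c ^ c * c ^ c) ≡⟨ *-assoc (suc c) (suc c ^ c) (c ^ c) ⟨
    suc c * suc c ^ c * c ^ c ∎
    where open ≤-Reasoning

  e⁻-mono : ∀ d j → e⁻ (suc j) ≼ e⁻ (suc j + d)
  e⁻-mono zero j rewrite +-identityʳ j = ≼-refl {e⁻ (suc j)}
  e⁻-mono (suc d) j rewrite +-suc j d =
    ≼-trans (e⁻ (suc j)) (e⁻ (suc j + d)) (e⁻ (suc (suc j + d))) {{c^c≢0 (suc j + d)}}
      (e⁻-mono d j) (e⁻-step (suc j + d))

  e⁺-antitone : ∀ d c → e⁺ (suc c + d) ≼ e⁺ (suc c)
  e⁺-antitone zero c rewrite +-identityʳ c = ≼-refl {e⁺ (suc c)}
  e⁺-antitone (suc d) c rewrite +-suc c d =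
    ≼-trans (e⁺ (suc (suc c + d))) (e⁺ (suc c + d)) (e⁺ (suc c)) {{m^n≢0 (suc c + d) (suc (suc c + d))}}
      (e⁺-step (suc c + d)) (e⁺-antitone d c)

  -- A single upper bound e⁺ C ≼ r bounds every e⁻ c: below C by monotonicity of e⁻,
  -- above C through e⁻ c ≼ e⁺ c ≼ e⁺ C.
  e⁻≼ : ∀ C r → .{{NonZero (proj₂ r)}} → e⁺ (suc C) ≼ r → ∀ c → .{{NonZero c}} → e⁻ c ≼ r
  e⁻≼ C r e⁺C≼r (suc j) with ≤-total (suc j) (suc C)
  ... | inj₁ j≤C = ≼-trans (e⁻ (suc j)) (e⁻ (suc C)) r {{c^c≢0 (suc C)}}
          (subst (λ z → e⁻ (suc j) ≼ e⁻ z) (m+[n∸m]≡n j≤C) (e⁻-mono (suc C ∸ suc j) j))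
          (≼-trans (e⁻ (suc C)) (e⁺ (suc C)) r {{m^n≢0 (suc C) (suc (suc C))}} (e⁻≼e⁺ (suc C)) e⁺C≼r)
  ... | inj₂ C≤j = ≼-trans (e⁻ (suc j)) (e⁺ (suc j)) r {{m^n≢0 (suc j) (suc (suc j))}} (e⁻≼e⁺ (suc j))
          (≼-trans (e⁺ (suc j)) (e⁺ (suc C)) r {{m^n≢0 (suc C) (suc (suc C))}}
            (subst (λ z → e⁺ z ≼ e⁺ (suc C)) (m+[n∸m]≡n C≤j) (e⁺-antitone (suc j ∸ suc C) C)) e⁺C≼r)

  25*[1+c]^c≤68*c^c : ∀ c → 25 * suc c ^ c ≤ 68 * c ^ c
  25*[1+c]^c≤68*c^c zero = m≤m+n 25 43
  25*[1+c]^c≤68*c^c c@(suc _) =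
    subst (_≤ 68 * c ^ c) (*-comm (suc c ^ c) 25)
      (e⁻≼ 999 (68 , 25) (toWitness {a? = 1001 ^ 1001 * 25 ≤? 68 * 1000 ^ 1001} _) c)

  25^k*k^k≤68^k*k! : ∀ k → 25 ^ k * k ^ k ≤ 68 ^ k * k !
  25^k*k^k≤68^k*k! zero = ≤-refl
  25^k*k^k≤68^k*k! (suc k) = begin
    25 * 25 ^ k * (suc k * suc k ^ k) ≡⟨ reorder₁ (25 ^ k) k (suc k ^ k) ⟩
    suc k * 25 ^ k * (25 * suc k ^ k) ≤⟨ *-monoʳ-≤ (suc k * 25 ^ k) (25*[1+c]^c≤68*c^c k) ⟩
    suc k * 25 ^ k * (68 * k ^ k) ≡⟨ reorder₂ (25 ^ k) k (k ^ k) ⟩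
    68 * suc k * (25 ^ k * k ^ k) ≤⟨ *-monoʳ-≤ (68 * suc k) (25^k*k^k≤68^k*k! k) ⟩
    68 * suc k * (68 ^ k * k !) ≡⟨ reorder₃ (68 ^ k) k (k !) ⟩
    68 * 68 ^ k * (suc k * k !) ∎
    where open ≤-Reasoning
          reorder₁ : ∀ a k b → 25 * a * (suc k * b) ≡ suc k * a * (25 * b)
          reorder₁ = solve-∀
          reorder₂ : ∀ a k b → suc k * a * (68 * b) ≡ 68 * suc k * (a * b)
          reorder₂ = solve-∀
          reorder₃ : ∀ a k b → 68 * suc k * (a * b) ≡ 68 * a * (suc k * b)
          reorder₃ = solve-∀

  [i+j]!≤i!*N^j : ∀ i j N → i + j ≤ N → (i + j) ! ≤ i ! * N ^ j
  [i+j]!≤i!*N^j i zero N _ rewrite +-identityʳ i = ≤-reflexive (sym (*-identityʳ (i !)))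
  [i+j]!≤i!*N^j i (suc j) N i+j<N rewrite +-suc i j = begin
    suc (i + j) * (i + j) ! ≤⟨ *-mono-≤ i+j<N ([i+j]!≤i!*N^j i j N (<⇒≤ i+j<N)) ⟩
    N * (i ! * N ^ j) ≡⟨ x∙yz≈y∙xz N (i !) (N ^ j) ⟩
    i ! * (N * N ^ j) ∎
    where open ≤-Reasoning

  N^j*N!≤[N+j]! : ∀ N j → N ^ j * N ! ≤ (N + j) !
  N^j*N!≤[N+j]! N zero rewrite +-identityʳ N = ≤-reflexive (*-identityˡ (N !))
  N^j*N!≤[N+j]! N (suc j) rewrite +-suc N j = begin
    N * N ^ j * N ! ≡⟨ *-assoc N _ _ ⟩
    N * (N ^ j * N !) ≤⟨ *-mono-≤ (m≤n⇒m≤1+n (m≤m+n N j)) (N^j*N!≤[N+j]! N j) ⟩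
    suc (N + j) * (N + j) ! ∎
    where open ≤-Reasoning

  -- The largest term of the series for e^N is the N-th.
  N^i*N!≤N^N*i! : ∀ N i → N ^ i * N ! ≤ N ^ N * i !
  N^i*N!≤N^N*i! N i with ≤-total i N
  ... | inj₁ i≤N = let (j , i+j≡N) = m≤n⇒∃[o]m+o≡n i≤N in begin
      N ^ i * N ! ≡⟨ cong (λ z → N ^ i * z !) i+j≡N ⟨
      N ^ i * (i + j) ! ≤⟨ *-monoʳ-≤ (N ^ i) ([i+j]!≤i!*N^j i j N (≤-reflexive i+j≡N)) ⟩
      N ^ i * (i ! * N ^ j) ≡⟨ x∙yz≈xz∙y (N ^ i) (i !) (N ^ j) ⟩
      N ^ i * N ^ j * i ! ≡⟨ cong (_* i !) (^-distribˡ-+-* N i j) ⟨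
      N ^ (i + j) * i ! ≡⟨ cong (λ z → N ^ z * i !) i+j≡N ⟩
      N ^ N * i ! ∎
    where open ≤-Reasoning
  ... | inj₂ N≤i = let (j , N+j≡i) = m≤n⇒∃[o]m+o≡n N≤i in begin
      N ^ i * N ! ≡⟨ cong (λ z → N ^ z * N !) N+j≡i ⟨
      N ^ (N + j) * N ! ≡⟨ cong (_* N !) (^-distribˡ-+-* N N j) ⟩
      N ^ N * N ^ j * N ! ≡⟨ *-assoc (N ^ N) _ _ ⟩
      N ^ N * (N ^ j * N !) ≤⟨ *-monoʳ-≤ (N ^ N) (N^j*N!≤[N+j]! N j) ⟩
      N ^ N * (N + j) ! ≡⟨ cong (λ z → N ^ N * z !) N+j≡i ⟩
      N ^ N * i ! ∎
    where open ≤-Reasoning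

  -- (2R)^i / i! ≤ e^{2R} ≤ (68/25)^{2R}, cleared of denominators.
  R^i*625^R*2^i≤4624^R*i! : ∀ R i → R ^ i * 625 ^ R * 2 ^ i ≤ 4624 ^ R * i !
  R^i*625^R*2^i≤4624^R*i! R i = *-cancelʳ-≤ _ _ (N !) {{N !≢0}} (begin
      R ^ i * 625 ^ R * 2 ^ i * N ! ≡⟨ cong (λ p → R ^ i * p * 2 ^ i * N !) (^-*-assoc 25 2 R) ⟩
      R ^ i * 25 ^ N * 2 ^ i * N ! ≡⟨ reorder (R ^ i) (25 ^ N) (2 ^ i) (N !) ⟩
      25 ^ N * ((2 ^ i * R ^ i) * N !) ≡⟨ cong (λ z → 25 ^ N * (z * N !)) (^-distribʳ-* 2 R i) ⟨
      25 ^ N * (N ^ i * N !) ≤⟨ *-monoʳ-≤ (25 ^ N) (N^i*N!≤N^N*i! N i) ⟩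
      25 ^ N * (N ^ N * i !) ≡⟨ *-assoc (25 ^ N) _ _ ⟨
      25 ^ N * N ^ N * i ! ≤⟨ *-monoˡ-≤ (i !) (25^k*k^k≤68^k*k! N) ⟩
      68 ^ N * N ! * i ! ≡⟨ xy∙z≈xz∙y (68 ^ N) (N !) (i !) ⟩
      68 ^ N * i ! * N ! ≡⟨ cong (λ z → z * i ! * N !) (^-*-assoc 68 2 R) ⟨
      4624 ^ R * i ! * N ! ∎)
    where
      open ≤-Reasoning
      N = 2 * R
      reorder : ∀ a b c d → a * b * c * d ≡ b * ((c * a) * d)
      reorder = solve-∀

module NumericBounds where
  open import Data.Nat
  open import Data.Nat.Properties
  open import Data.Product using (_,_)
  open import Relation.Binary.PropositionalEquality
  open import Relation.Nullary.Decidable using (toWitness)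
  open import Data.Nat.Tactic.RingSolver
  open import Algebra.Properties.CommutativeSemigroup *-commutativeSemigroup using (xy∙z≈xz∙y; xy∙z≈y∙xz; x∙yz≈y∙xz; x∙yz≈yx∙z; xy∙z≈zx∙y)
  open PowerBounds
  open EulerBounds

  q^b*p^a≤p^b*q^a : ∀ p q a b → q ≤ p → a ≤ b → q ^ b * p ^ a ≤ p ^ b * q ^ a
  q^b*p^a≤p^b*q^a p q a b q≤p a≤b = let (t , a+t≡b) = m≤n⇒∃[o]m+o≡n a≤b in begin
      q ^ b * p ^ a ≡⟨ cong (λ z → q ^ z * p ^ a) a+t≡b ⟨
      q ^ (a + t) * p ^ a ≡⟨ cong (_* p ^ a) (^-distribˡ-+-* q a t) ⟩
      q ^ a * q ^ t * p ^ a ≤⟨ *-monoˡ-≤ (p ^ a) (*-monoʳ-≤ (q ^ a) (^-monoˡ-≤ t q≤p)) ⟩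
      q ^ a * p ^ t * p ^ a ≡⟨ reorder (q ^ a) (p ^ t) (p ^ a) ⟩
      p ^ a * p ^ t * q ^ a ≡⟨ cong (_* q ^ a) (^-distribˡ-+-* p a t) ⟨
      p ^ (a + t) * q ^ a ≡⟨ cong (λ z → p ^ z * q ^ a) a+t≡b ⟩
      p ^ b * q ^ a ∎
    where open ≤-Reasoning
          reorder : ∀ x y z → x * y * z ≡ z * y * x
          reorder = solve-∀

  *-cross-≤ : ∀ A B C D K₁ K₂ → .{{NonZero K₁}} → A * K₁ ≤ B * K₂ → K₂ * C ≤ K₁ * D → A * C ≤ B * D
  *-cross-≤ A B C D K₁ K₂ AK₁≤BK₂ K₂C≤K₁D = *-cancelʳ-≤ _ _ K₁ (begin
    A * C * K₁ ≡⟨ xy∙z≈xz∙y A C K₁ ⟩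
    A * K₁ * C ≤⟨ *-monoˡ-≤ C AK₁≤BK₂ ⟩
    B * K₂ * C ≡⟨ *-assoc B K₂ C ⟩
    B * (K₂ * C) ≤⟨ *-monoʳ-≤ B K₂C≤K₁D ⟩
    B * (K₁ * D) ≡⟨ *-assoc B K₁ D ⟨
    B * K₁ * D ≡⟨ xy∙z≈xz∙y B K₁ D ⟩
    B * D * K₁ ∎)
    where open ≤-Reasoning

  *-^-mono-≤ : ∀ a b c d n → a * b ≤ c * d → a ^ n * b ^ n ≤ c ^ n * d ^ n
  *-^-mono-≤ a b c d n ab≤cd = begin
    a ^ n * b ^ n ≡⟨ ^-distribʳ-* a b n ⟨
    (a * b) ^ n ≤⟨ ^-monoˡ-≤ n ab≤cd ⟩
    (c * d) ^ n ≡⟨ ^-distribʳ-* c d n ⟩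
    c ^ n * d ^ n ∎
    where open ≤-Reasoning

  -- From x ≤ r^e one gets x^d ≤ r^k, provided r ≤ 1 and k ≤ e d (here r = q/p),
  -- or r ≥ 1 and e d ≤ k (here r = p/q); x = num/den.
  ^-trade-≤1 : ∀ num den p q e k d → .{{NonZero p}} → num * p ^ e ≤ den * q ^ e → q ≤ p → k ≤ e * d →
               num ^ d * p ^ k ≤ den ^ d * q ^ k
  ^-trade-≤1 num den p q e k d base q≤p k≤ed =
    *-cross-≤ (num ^ d) (den ^ d) (p ^ k) (q ^ k) (p ^ (e * d)) (q ^ (e * d)) {{m^n≢0 p (e * d)}}
      (subst₂ (λ x y → num ^ d * x ≤ den ^ d * y) (^-*-assoc p e d) (^-*-assoc q e d)
        (*-^-mono-≤ num (p ^ e) den (q ^ e) d base))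
      (q^b*p^a≤p^b*q^a p q k (e * d) q≤p k≤ed)

  ^-trade-≥1 : ∀ num den p q e k d → .{{NonZero q}} → num * q ^ e ≤ den * p ^ e → q ≤ p → e * d ≤ k →
               num ^ d * q ^ k ≤ den ^ d * p ^ k
  ^-trade-≥1 num den p q e k d base q≤p ed≤k =
    *-cross-≤ (num ^ d) (den ^ d) (q ^ k) (p ^ k) (q ^ (e * d)) (p ^ (e * d)) {{m^n≢0 q (e * d)}}
      (subst₂ (λ x y → num ^ d * x ≤ den ^ d * y) (^-*-assoc q e d) (^-*-assoc p e d)
        (*-^-mono-≤ num (q ^ e) den (p ^ e) d base))
      (subst₂ _≤_ (*-comm (q ^ k) (p ^ (e * d))) (*-comm (p ^ k) (q ^ (e * d)))
        (q^b*p^a≤p^b*q^a p q (e * d) k q≤p ed≤k))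

  4624^d*1000^k≤6250^d*997^k : ∀ k d → k ≤ 100 * d → 4624 ^ d * 1000 ^ k ≤ 6250 ^ d * 997 ^ k
  4624^d*1000^k≤6250^d*997^k k d =
    ^-trade-≤1 4624 6250 1000 997 100 k d (toWitness {a? = 4624 * 1000 ^ 100 ≤? 6250 * 997 ^ 100} _) (m≤m+n 997 3)

  4624^R*1000^k≤625^R*1001^k : ∀ R k → 10000 * R ≤ k → 4624 ^ R * 1000 ^ k ≤ 625 ^ R * 1001 ^ k
  4624^R*1000^k≤625^R*1001^k R k =
    ^-trade-≥1 4624 625 1001 1000 10000 k R (toWitness {a? = 4624 * 1000 ^ 10000 ≤? 625 * 1001 ^ 10000} _) (n≤1+n 1000)

  2*4624*9993^k≤625*10000^k : ∀ k → 100000 ≤ k → 2 * 4624 * 9993 ^ k ≤ 625 * 10000 ^ k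
  2*4624*9993^k≤625*10000^k k@(suc k′) 100000≤k = *-cancelʳ-≤ _ _ 9993 (begin
      2 * 4624 * (9993 * X) * 9993 ≡⟨ evaluate X ⟩
      92415264 * (9993 * X) ≤⟨ *-monoˡ-≤ (9993 * X) (toWitness {a? = 92415264 ≤? 625 * 7 * 100000} _) ⟩
      625 * 7 * 100000 * (9993 * X) ≤⟨ *-monoˡ-≤ (9993 * X) (*-monoʳ-≤ (625 * 7) 100000≤k) ⟩
      625 * 7 * k * (9993 * X) ≡⟨ reorder k′ X ⟩
      625 * (k * 7 * X) * 9993 ≤⟨ *-monoˡ-≤ 9993 (*-monoʳ-≤ 625 (≤-trans (m≤n+m (k * 7 * X) (9993 * X)) (+-^-lowerBound 9993 7 k′))) ⟩
      625 * (9993 + 7) ^ k * 9993 ∎)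
    where open ≤-Reasoning
          X = 9993 ^ k′
          evaluate : ∀ X → 2 * 4624 * (9993 * X) * 9993 ≡ 92415264 * (9993 * X)
          evaluate = solve-∀
          reorder : ∀ k X → 625 * 7 * suc k * (9993 * X) ≡ 625 * (suc k * 7 * X) * 9993
          reorder = solve-∀

  -- The hypothesis on n is used as A₁ n ≤ A₂ k², where A₂/A₁ = (1 + 10⁻⁷)·60/163:
  -- 163/60 is a lower bound for e and 10⁻⁷ an upper bound for e^{-600}.
  A₁ A₂ : ℕ
  A₁ = 1630000000
  A₂ = 600000060

  -- Each common symbol costs a factor αₙ/α_d = (68/25)(A₂/A₁) ≈ 1.0012 and each rare one
  -- saves a factor βₙ/β_d = (68/25)²/10 ≈ 0.74, where 68/25 ≥ e.
  αₙ α_d βₙ β_d : ℕ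
  αₙ = 68 * A₂
  α_d = 25 * A₁
  βₙ = 68 * 68
  β_d = 25 * 10 * 25

  -- With d ≥ k/100 rare symbols the saving (0.74)^d beats the cost (1.0012)^c, the
  -- factor (4624/625)^R ≥ e^{2R} coming from R ≈ k/10000 and the constant 2.
  slack : ∀ k c d R → c + d ≡ k → k ≤ 100 * d → 10000 * R ≤ k → 100000 ≤ k →
          2 * 4624 ^ suc R * αₙ ^ c * βₙ ^ d ≤ 625 ^ suc R * α_d ^ c * β_d ^ d
  slack k c d R c+d≡k k≤100d 10000R≤k 100000≤k = *-cancelʳ-≤ _ _ W {{W≢0}} (begin
      2 * 4624 ^ suc R * αₙ ^ c * βₙ ^ d * W
        ≡⟨ regroupˡ (αₙ ^ c) (βₙ ^ d) (4624 ^ R) 1000ᵏ (α_d ^ k) (αₙ ^ k) 997ᵏ 1001ᵏ 10000ᵏ 9993ᵏ ⟩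
      (βₙ ^ d * 1000ᵏ) * (αₙ ^ c * α_d ^ k) * (4624 ^ R * 1000ᵏ) * (αₙ ^ k * 997ᵏ * 1001ᵏ * 10000ᵏ) * (2 * 4624 * 9993ᵏ)
        ≤⟨ *-mono-≤ (*-mono-≤ (*-mono-≤ (*-mono-≤ rare common) extraFactor) product≤1) constant ⟩
      (β_d ^ d * 997ᵏ) * (α_d ^ c * αₙ ^ k) * (625 ^ R * 1001ᵏ) * (α_d ^ k * 1000ᵏ * 1000ᵏ * 9993ᵏ) * (625 * 10000ᵏ)
        ≡⟨ regroupʳ (α_d ^ c) (β_d ^ d) (625 ^ R) 1000ᵏ (α_d ^ k) (αₙ ^ k) 997ᵏ 1001ᵏ 10000ᵏ 9993ᵏ ⟩
      625 ^ suc R * α_d ^ c * β_d ^ d * W ∎)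
    where
      open ≤-Reasoning
      1000ᵏ = 1000 ^ k
      997ᵏ = 997 ^ k
      1001ᵏ = 1001 ^ k
      10000ᵏ = 10000 ^ k
      9993ᵏ = 9993 ^ k
      W = 1000ᵏ * 1000ᵏ * α_d ^ k * αₙ ^ k * 997ᵏ * 1001ᵏ * 10000ᵏ * 9993ᵏ
      W≢0 : NonZero W
      W≢0 = m*n≢0 _ _ {{m*n≢0 _ _ {{m*n≢0 _ _ {{m*n≢0 _ _ {{m*n≢0 _ _ {{m*n≢0 _ _ {{m*n≢0 _ _ {{m^n≢0 1000 k}} {{m^n≢0 1000 k}}}}
              {{m^n≢0 α_d k}}}} {{m^n≢0 αₙ k}}}} {{m^n≢0 997 k}}}} {{m^n≢0 1001 k}}}} {{m^n≢0 10000 k}}}} {{m^n≢0 9993 k}}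
      rare = 4624^d*1000^k≤6250^d*997^k k d k≤100d
      common : αₙ ^ c * α_d ^ k ≤ α_d ^ c * αₙ ^ k
      common = subst₂ _≤_ (*-comm (α_d ^ k) (αₙ ^ c)) (*-comm (αₙ ^ k) (α_d ^ c))
        (q^b*p^a≤p^b*q^a αₙ α_d c k (toWitness {a? = α_d ≤? αₙ} _) (subst (c ≤_) c+d≡k (m≤m+n c d)))
      extraFactor = 4624^R*1000^k≤625^R*1001^k R k 10000R≤k
      product≤1 : αₙ ^ k * 997ᵏ * 1001ᵏ * 10000ᵏ ≤ α_d ^ k * 1000ᵏ * 1000ᵏ * 9993ᵏ
      product≤1 = subst₂ _≤_ (distrib⁴ αₙ 997 1001 10000) (distrib⁴ α_d 1000 1000 9993)
          (^-monoˡ-≤ k (toWitness {a? = αₙ * 997 * 1001 * 10000 ≤? α_d * 1000 * 1000 * 9993} _))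
        where distrib⁴ : ∀ a b c d → (a * b * c * d) ^ k ≡ a ^ k * b ^ k * c ^ k * d ^ k
              distrib⁴ a b c d = trans (^-distribʳ-* (a * b * c) d k)
                (cong (_* d ^ k) (trans (^-distribʳ-* (a * b) c k) (cong (_* c ^ k) (^-distribʳ-* a b k))))
      constant = 2*4624*9993^k≤625*10000^k k 100000≤k
      regroupˡ : ∀ A B F x1 adk ank x7 x11 x10 x93 → 2 * (4624 * F) * A * B * (x1 * x1 * adk * ank * x7 * x11 * x10 * x93)
                 ≡ (B * x1) * (A * adk) * (F * x1) * (ank * x7 * x11 * x10) * (2 * 4624 * x93)
      regroupˡ = solve-∀
      regroupʳ : ∀ A B F x1 adk ank x7 x11 x10 x93 → (B * x7) * (A * ank) * (F * x11) * (adk * x1 * x1 * x93) * (625 * x10)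
                 ≡ 625 * F * A * B * (x1 * x1 * adk * ank * x7 * x11 * x10 * x93)
      regroupʳ = solve-∀

  [c+d]*c^d≤c*[1+c]^d : ∀ c d → (c + d) * c ^ d ≤ c * suc c ^ d
  [c+d]*c^d≤c*[1+c]^d c zero = ≤-reflexive (cong (_* 1) (+-identityʳ c))
  [c+d]*c^d≤c*[1+c]^d c (suc d) = begin
    (c + suc d) * (c * c ^ d) ≡⟨ expand c d (c ^ d) ⟩
    c * (c * c ^ d + suc d * 1 * c ^ d) ≤⟨ *-monoʳ-≤ c (+-^-lowerBound c 1 d) ⟩
    c * (c + 1) ^ suc d ≡⟨ cong (λ z → c * z ^ suc d) (+-comm c 1) ⟩
    c * suc c ^ suc d ∎
    where open ≤-Reasoning
          expand : ∀ c d x → (c + suc d) * (c * x) ≡ c * (c * x + suc d * 1 * x)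
          expand = solve-∀

  -- (k/c)^c ≤ (68/25)^d for k = c + d: raise (1 + d/c) ≤ (1 + 1/c)^d to the c-th power.
  [c+d]^c*25^d≤68^d*c^c : ∀ c d → (c + d) ^ c * 25 ^ d ≤ 68 ^ d * c ^ c
  [c+d]^c*25^d≤68^d*c^c c d = *-cancelʳ-≤ _ _ U {{m^n≢0 (c ^ c) d {{c^c≢0 c}}}} (begin
      (c + d) ^ c * 25 ^ d * U ≡⟨ xy∙z≈y∙xz ((c + d) ^ c) (25 ^ d) U ⟩
      25 ^ d * ((c + d) ^ c * U) ≡⟨ cong (λ z → 25 ^ d * ((c + d) ^ c * z)) (^-comm c c d) ⟩
      25 ^ d * ((c + d) ^ c * (c ^ d) ^ c) ≡⟨ cong (25 ^ d *_) (^-distribʳ-* (c + d) (c ^ d) c) ⟨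
      25 ^ d * ((c + d) * c ^ d) ^ c ≤⟨ *-monoʳ-≤ (25 ^ d) (^-monoˡ-≤ c ([c+d]*c^d≤c*[1+c]^d c d)) ⟩
      25 ^ d * (c * suc c ^ d) ^ c ≡⟨ cong (25 ^ d *_) (^-distribʳ-* c (suc c ^ d) c) ⟩
      25 ^ d * (c ^ c * (suc c ^ d) ^ c) ≡⟨ x∙yz≈y∙xz (25 ^ d) (c ^ c) _ ⟩
      c ^ c * (25 ^ d * (suc c ^ d) ^ c) ≡⟨ cong (λ z → c ^ c * (25 ^ d * z)) (^-comm (suc c) d c) ⟩
      c ^ c * (25 ^ d * (suc c ^ c) ^ d) ≤⟨ *-monoʳ-≤ (c ^ c) (*-^-mono-≤ 25 (suc c ^ c) 68 (c ^ c) d (25*[1+c]^c≤68*c^c c)) ⟩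
      c ^ c * (68 ^ d * U) ≡⟨ x∙yz≈yx∙z (c ^ c) (68 ^ d) U ⟩
      68 ^ d * c ^ c * U ∎)
    where
      open ≤-Reasoning
      U = (c ^ c) ^ d
      ^-comm : ∀ a b e → (a ^ b) ^ e ≡ (a ^ e) ^ b
      ^-comm a b e = trans (^-*-assoc a b e) (trans (cong (a ^_) (*-comm b e)) (sym (^-*-assoc a e b)))

  occurrenceProduct*A₁^c≤ : ∀ k c d n Π → c ^ c * 10 ^ d * Π ≤ n ^ c * k ^ d → A₁ * n ≤ A₂ * (k * k) →
    c ^ c * 10 ^ d * Π * A₁ ^ c ≤ A₂ ^ c * (k ^ c * k ^ c) * k ^ d
  occurrenceProduct*A₁^c≤ k c d n Π c^c10^dΠ≤n^ck^d A₁n≤A₂k² = begin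
    c ^ c * 10 ^ d * Π * A₁ ^ c ≤⟨ *-monoˡ-≤ (A₁ ^ c) c^c10^dΠ≤n^ck^d ⟩
    n ^ c * k ^ d * A₁ ^ c ≡⟨ xy∙z≈zx∙y (n ^ c) (k ^ d) (A₁ ^ c) ⟩
    A₁ ^ c * n ^ c * k ^ d ≡⟨ cong (_* k ^ d) (^-distribʳ-* A₁ n c) ⟨
    (A₁ * n) ^ c * k ^ d ≤⟨ *-monoˡ-≤ (k ^ d) (^-monoˡ-≤ c A₁n≤A₂k²) ⟩
    (A₂ * (k * k)) ^ c * k ^ d ≡⟨ cong (_* k ^ d) (trans (^-distribʳ-* A₂ (k * k) c) (cong (A₂ ^ c *_) (^-distribʳ-* k k c))) ⟩
    A₂ ^ c * (k ^ c * k ^ c) * k ^ d ∎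
    where open ≤-Reasoning

  -- Product of occurrences ≤ (αₙ/α_d)^c (βₙ/β_d)^d k!, combining the AM-GM bound
  -- c^c 10^d Π ≤ n^c k^d with n ≤ (A₂/A₁)k², (k/c)^c ≤ (68/25)^d and k^k ≤ (68/25)^k k!.
  occurrenceProduct≤ : ∀ k c d n Π → .{{NonZero k}} → c + d ≡ k →
    c ^ c * 10 ^ d * Π ≤ n ^ c * k ^ d → A₁ * n ≤ A₂ * (k * k) →
    α_d ^ c * β_d ^ d * Π ≤ αₙ ^ c * βₙ ^ d * k !
  occurrenceProduct≤ k c d n Π c+d≡k c^c10^dΠ≤n^ck^d A₁n≤A₂k² = *-cancelˡ-≤ kᶜ {{m^n≢0 k c}} (begin
      kᶜ * (α_d ^ c * β_d ^ d * Π) ≡⟨ cong₂ (λ x y → kᶜ * (x * y * Π)) α_d^c β_d^d ⟩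
      kᶜ * ((25ᶜ * A₁ᶜ) * (25ᵈ * 10ᵈ * 25ᵈ) * Π) ≡⟨ regroup₁ kᶜ 25ᶜ A₁ᶜ 25ᵈ 10ᵈ Π ⟩
      (25ᶜ * 25ᵈ * (10ᵈ * A₁ᶜ * Π)) * (kᶜ * 25ᵈ) ≤⟨ *-monoʳ-≤ (25ᶜ * 25ᵈ * (10ᵈ * A₁ᶜ * Π)) k^c*25^d≤68^d*c^c ⟩
      (25ᶜ * 25ᵈ * (10ᵈ * A₁ᶜ * Π)) * (68ᵈ * cᶜ) ≡⟨ regroup₂ 25ᶜ 25ᵈ 10ᵈ A₁ᶜ Π 68ᵈ cᶜ ⟩
      (25ᶜ * 25ᵈ * 68ᵈ) * (cᶜ * 10ᵈ * Π * A₁ᶜ) ≤⟨ *-monoʳ-≤ (25ᶜ * 25ᵈ * 68ᵈ) (occurrenceProduct*A₁^c≤ k c d n Π c^c10^dΠ≤n^ck^d A₁n≤A₂k²) ⟩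
      (25ᶜ * 25ᵈ * 68ᵈ) * (A₂ᶜ * (kᶜ * kᶜ) * kᵈ) ≡⟨ regroup₃ 25ᶜ 25ᵈ 68ᵈ A₂ᶜ kᶜ kᵈ ⟩
      kᶜ * (68ᵈ * A₂ᶜ * ((25ᶜ * 25ᵈ) * (kᶜ * kᵈ))) ≡⟨ cong₂ (λ x y → kᶜ * (68ᵈ * A₂ᶜ * (x * y))) (split^ 25) (split^ k) ⟨
      kᶜ * (68ᵈ * A₂ᶜ * (25 ^ k * k ^ k)) ≤⟨ *-monoʳ-≤ kᶜ (*-monoʳ-≤ (68ᵈ * A₂ᶜ) (25^k*k^k≤68^k*k! k)) ⟩
      kᶜ * (68ᵈ * A₂ᶜ * (68 ^ k * k !)) ≡⟨ cong (λ x → kᶜ * (68ᵈ * A₂ᶜ * (x * k !))) (split^ 68) ⟩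
      kᶜ * (68ᵈ * A₂ᶜ * ((68ᶜ * 68ᵈ) * k !)) ≡⟨ regroup₄ kᶜ 68ᵈ A₂ᶜ 68ᶜ (k !) ⟩
      kᶜ * ((68ᶜ * A₂ᶜ) * (68ᵈ * 68ᵈ) * k !) ≡⟨ cong₂ (λ x y → kᶜ * (x * y * k !)) αₙ^c βₙ^d ⟨
      kᶜ * (αₙ ^ c * βₙ ^ d * k !) ∎)
    where
      open ≤-Reasoning
      kᶜ = k ^ c
      A₁ᶜ = A₁ ^ c
      A₂ᶜ = A₂ ^ c
      25ᶜ = 25 ^ c
      25ᵈ = 25 ^ d
      68ᶜ = 68 ^ c
      68ᵈ = 68 ^ d
      10ᵈ = 10 ^ d
      kᵈ = k ^ d
      cᶜ = c ^ c
      α_d^c : α_d ^ c ≡ 25ᶜ * A₁ᶜ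
      α_d^c = ^-distribʳ-* 25 A₁ c
      β_d^d : β_d ^ d ≡ 25ᵈ * 10ᵈ * 25ᵈ
      β_d^d = trans (^-distribʳ-* (25 * 10) 25 d) (cong (_* 25ᵈ) (^-distribʳ-* 25 10 d))
      αₙ^c : αₙ ^ c ≡ 68ᶜ * A₂ᶜ
      αₙ^c = ^-distribʳ-* 68 A₂ c
      βₙ^d : βₙ ^ d ≡ 68ᵈ * 68ᵈ
      βₙ^d = ^-distribʳ-* 68 68 d
      split^ : ∀ x → x ^ k ≡ x ^ c * x ^ d
      split^ x = trans (cong (x ^_) (sym c+d≡k)) (^-distribˡ-+-* x c d)
      k^c*25^d≤68^d*c^c : kᶜ * 25ᵈ ≤ 68ᵈ * cᶜ
      k^c*25^d≤68^d*c^c = subst (λ z → z ^ c * 25ᵈ ≤ 68ᵈ * cᶜ) c+d≡k ([c+d]^c*25^d≤68^d*c^c c d)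
      regroup₁ : ∀ kᶜ 25ᶜ A₁ᶜ 25ᵈ 10ᵈ P → kᶜ * ((25ᶜ * A₁ᶜ) * (25ᵈ * 10ᵈ * 25ᵈ) * P) ≡ (25ᶜ * 25ᵈ * (10ᵈ * A₁ᶜ * P)) * (kᶜ * 25ᵈ)
      regroup₁ = solve-∀
      regroup₂ : ∀ 25ᶜ 25ᵈ 10ᵈ A₁ᶜ P 68ᵈ cᶜ → (25ᶜ * 25ᵈ * (10ᵈ * A₁ᶜ * P)) * (68ᵈ * cᶜ) ≡ (25ᶜ * 25ᵈ * 68ᵈ) * (cᶜ * 10ᵈ * P * A₁ᶜ)
      regroup₂ = solve-∀
      regroup₃ : ∀ 25ᶜ 25ᵈ 68ᵈ A₂ᶜ kᶜ kᵈ → (25ᶜ * 25ᵈ * 68ᵈ) * (A₂ᶜ * (kᶜ * kᶜ) * kᵈ) ≡ kᶜ * (68ᵈ * A₂ᶜ * ((25ᶜ * 25ᵈ) * (kᶜ * kᵈ)))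
      regroup₃ = solve-∀
      regroup₄ : ∀ kᶜ 68ᵈ A₂ᶜ 68ᶜ kf → kᶜ * (68ᵈ * A₂ᶜ * ((68ᶜ * 68ᵈ) * kf)) ≡ kᶜ * ((68ᶜ * A₂ᶜ) * (68ᵈ * 68ᵈ) * kf)
      regroup₄ = solve-∀

  P*2*4624^[1+R]≤k!*625^[1+R] : ∀ k c d n Π P R →
    c + d ≡ k → k ≤ 100 * d → 10000 * R ≤ k → 100000 ≤ k →
    c ^ c * 10 ^ d * Π ≤ n ^ c * k ^ d → A₁ * n ≤ A₂ * (k * k) → P ≤ Π →
    P * 2 * 4624 ^ suc R ≤ k ! * 625 ^ suc R
  P*2*4624^[1+R]≤k!*625^[1+R] k c d n Π P R c+d≡k k≤100d 10000R≤k 100000≤k amgmBound A₁n≤A₂k² P≤Π =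
    *-cancelʳ-≤ _ _ Z {{m*n≢0 _ _ {{m^n≢0 α_d c}} {{m^n≢0 β_d d}}}} (begin
      P * 2 * 4624 ^ suc R * Z ≤⟨ *-monoˡ-≤ Z (*-monoˡ-≤ (4624 ^ suc R) (*-monoˡ-≤ 2 P≤Π)) ⟩
      Π * 2 * 4624 ^ suc R * Z ≡⟨ regroup₁ Π (4624 ^ suc R) (α_d ^ c) (β_d ^ d) ⟩
      2 * 4624 ^ suc R * (α_d ^ c * β_d ^ d * Π)
        ≤⟨ *-monoʳ-≤ (2 * 4624 ^ suc R) (occurrenceProduct≤ k c d n Π {{k≢0}} c+d≡k amgmBound A₁n≤A₂k²) ⟩
      2 * 4624 ^ suc R * (αₙ ^ c * βₙ ^ d * k !) ≡⟨ regroup₂ (4624 ^ suc R) (αₙ ^ c) (βₙ ^ d) (k !) ⟩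
      2 * 4624 ^ suc R * αₙ ^ c * βₙ ^ d * k ! ≤⟨ *-monoˡ-≤ (k !) (slack k c d R c+d≡k k≤100d 10000R≤k 100000≤k) ⟩
      625 ^ suc R * α_d ^ c * β_d ^ d * k ! ≡⟨ regroup₃ (625 ^ suc R) (α_d ^ c) (β_d ^ d) (k !) ⟩
      k ! * 625 ^ suc R * Z ∎)
    where
      open ≤-Reasoning
      Z = α_d ^ c * β_d ^ d
      k≢0 : NonZero k
      k≢0 = >-nonZero (≤-trans (s≤s z≤n) 100000≤k)
      regroup₁ : ∀ p f a b → p * 2 * f * (a * b) ≡ 2 * f * (a * b * p)
      regroup₁ = solve-∀
      regroup₂ : ∀ f a b x → 2 * f * (a * b * x) ≡ 2 * f * a * b * x
      regroup₂ = solve-∀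
      regroup₃ : ∀ g a b x → g * a * b * x ≡ x * g * (a * b)
      regroup₃ = solve-∀

module Arrangements where
  open import Data.Nat using (ℕ; zero; suc; _+_; _*_; _≤_; z≤n)
  open import Data.Nat.Properties using (+-suc; *-distribʳ-+; *-distribˡ-+; +-mono-≤; ≤-reflexive; module ≤-Reasoning)
  open import Data.Fin as F using (Fin; zero; suc)
  open import Data.Fin.Properties using (suc-injective)
  open import Data.Bool using (Bool; true; false; if_then_else_)
  open import Data.List using (List; []; _∷_; length; filter)
  open import Data.List.Properties using (filter-accept; filter-reject)
  open import Data.List.Relation.Unary.All as All using (All; []; _∷_)
  open import Data.List.Relation.Unary.AllPairs using ([]; _∷_)
  open import Data.List.Relation.Unary.Unique.Propositional using (Unique)
  open import Data.List.Relation.Unary.Any using (here; there)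
  open import Data.List.Membership.Propositional using (_∈_)
  open import Data.List.Relation.Binary.Sublist.Propositional using (_⊆_; []; _∷_; _∷ʳ_; minimum)
  open import Data.List.Relation.Binary.Sublist.Propositional.Properties using (∷ˡ⁻)
  open import Data.Product using (_×_; _,_; proj₁; proj₂; map₁; map₂)
  open import Data.Unit using (⊤; tt)
  open import Data.Vec.Functional using (tail)
  open import Function using (_∘′_)
  open import Data.Empty using (⊥; ⊥-elim)
  open import Relation.Nullary using (yes; no; ¬_)
  open import Relation.Binary.PropositionalEquality

  private
    variable
      k : ℕ

  occurrences : List (Fin k) → Fin k → ℕ
  occurrences σ m = length (filter (F._≟ m) σ)

  occurrences-here : ∀ (x : Fin k) σ → occurrences (x ∷ σ) x ≡ suc (occurrences σ x)
  occurrences-here x σ = cong length (filter-accept (F._≟ x) refl)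

  occurrences-there : ∀ {x m : Fin k} σ → x ≢ m → occurrences (x ∷ σ) m ≡ occurrences σ m
  occurrences-there {m = m} σ x≢m = cong length (filter-reject (F._≟ m) x≢m)

  ∏ : (Fin k → ℕ) → ℕ
  ∏ {zero} f = 1
  ∏ {suc k} f = f zero * ∏ (tail f)

  ∏-cong : ∀ {f g : Fin k → ℕ} → (∀ i → f i ≡ g i) → ∏ f ≡ ∏ g
  ∏-cong {zero} f≗g = refl
  ∏-cong {suc k} f≗g = cong₂ _*_ (f≗g zero) (∏-cong (λ i → f≗g (suc i)))

  ∏-ones : ∀ (f : Fin k → ℕ) → (∀ i → f i ≡ 1) → ∏ f ≡ 1
  ∏-ones {zero} f f≗1 = refl
  ∏-ones {suc k} f f≗1 rewrite f≗1 zero | ∏-ones _ (λ i → f≗1 (suc i)) = refl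

  ∏-+-at : ∀ (x : Fin k) (f g h : Fin k → ℕ) → (∀ m → m ≢ x → f m ≡ h m) → (∀ m → m ≢ x → g m ≡ h m) →
           h x ≡ f x + g x → ∏ f + ∏ g ≡ ∏ h
  ∏-+-at zero f g h f≈h g≈h hx = begin
      f zero * ∏ (tail f) + g zero * ∏ (tail g)
        ≡⟨ cong₂ (λ a b → f zero * a + g zero * b) (∏-cong (λ i → f≈h (suc i) λ ())) (∏-cong (λ i → g≈h (suc i) λ ())) ⟩
      f zero * ∏ (tail h) + g zero * ∏ (tail h) ≡⟨ *-distribʳ-+ (∏ (tail h)) (f zero) (g zero) ⟨
      (f zero + g zero) * ∏ (tail h) ≡⟨ cong (_* ∏ (tail h)) hx ⟨
      h zero * ∏ (tail h) ∎
    where open ≡-Reasoning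
  ∏-+-at (suc x) f g h f≈h g≈h hx = begin
      f zero * ∏ (tail f) + g zero * ∏ (tail g) ≡⟨ cong₂ (λ a b → a * ∏ (tail f) + b * ∏ (tail g)) (f≈h zero λ ()) (g≈h zero λ ()) ⟩
      h zero * ∏ (tail f) + h zero * ∏ (tail g) ≡⟨ *-distribˡ-+ (h zero) _ _ ⟨
      h zero * (∏ (tail f) + ∏ (tail g))
        ≡⟨ cong (h zero *_) (∏-+-at x (tail f) (tail g) (tail h)
             (λ m m≢x → f≈h (suc m) (m≢x ∘′ suc-injective)) (λ m m≢x → g≈h (suc m) (m≢x ∘′ suc-injective)) hx) ⟩
      h zero * ∏ (tail h) ∎
    where open ≡-Reasoning

  Arrangement : (Fin k → Bool) → List (Fin k) → Set
  Arrangement A w = Unique w × (∀ m → m ∈ w → A m ≡ true) × (∀ m → A m ≡ true → m ∈ w)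

  remove : Fin k → (Fin k → Bool) → Fin k → Bool
  remove x A m with m F.≟ x
  ... | yes _ = false
  ... | no _ = A m

  remove-≢ : ∀ (x : Fin k) A {m} → m ≢ x → remove x A m ≡ A m
  remove-≢ x A {m} m≢x with m F.≟ x
  ... | yes m≡x = ⊥-elim (m≢x m≡x)
  ... | no _ = refl

  remove-self : ∀ (x : Fin k) A → remove x A x ≡ false
  remove-self x A with x F.≟ x
  ... | yes _ = refl
  ... | no x≢x = ⊥-elim (x≢x refl)

  remove-true : ∀ (x : Fin k) A m → remove x A m ≡ true → m ≢ x × A m ≡ true
  remove-true x A m h with m F.≟ x
  remove-true x A m () | yes _
  ... | no m≢x = m≢x , h

  weight : (Fin k → Bool) → List (Fin k) → ℕ
  weight A σ = ∏ (λ m → if A m then occurrences σ m else 1)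

  weight-∷-true : ∀ {A} (x : Fin k) σ → A x ≡ true → weight (remove x A) σ + weight A σ ≡ weight A (x ∷ σ)
  weight-∷-true {k} {A} x σ Ax = ∏-+-at x f g h f≈h g≈h hx
    where
      f g h : Fin k → ℕ
      f m = if remove x A m then occurrences σ m else 1
      g m = if A m then occurrences σ m else 1
      h m = if A m then occurrences (x ∷ σ) m else 1
      g≈h : ∀ m → m ≢ x → g m ≡ h m
      g≈h m m≢x = cong (λ o → if A m then o else 1) (sym (occurrences-there σ λ x≡m → m≢x (sym x≡m)))
      f≈h : ∀ m → m ≢ x → f m ≡ h m
      f≈h m m≢x = trans (cong (λ b → if b then occurrences σ m else 1) (remove-≢ x A m≢x)) (g≈h m m≢x)
      hx : h x ≡ f x + g x
      hx rewrite Ax | remove-self x A = occurrences-here x σ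

  weight-∷-false : ∀ {A} (x : Fin k) σ → A x ≡ false → weight A σ ≡ weight A (x ∷ σ)
  weight-∷-false {A = A} x σ Ax = ∏-cong pointwise
    where
      pointwise : ∀ m → (if A m then occurrences σ m else 1) ≡ (if A m then occurrences (x ∷ σ) m else 1)
      pointwise m with m F.≟ x
      ... | yes refl rewrite Ax = refl
      ... | no m≢x = cong (λ o → if A m then o else 1) (sym (occurrences-there σ λ x≡m → m≢x (sym x≡m)))

  weight-[] : ∀ A → (∀ (m : Fin k) → A m ≢ true) → weight A [] ≡ 1
  weight-[] A ¬A = ∏-ones _ λ m → if-false (A m) (¬A m)
    where if-false : ∀ b → b ≢ true → (if b then 0 else 1) ≡ 1
          if-false true b≢true = ⊥-elim (b≢true refl)
          if-false false _ = refl

  Words : ℕ → Set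
  Words k = List (List (Fin k))

  splitByHead : Fin k → Words k → Words k × Words k
  splitByHead x [] = [] , []
  splitByHead x ([] ∷ L) = map₂ ([] ∷_) (splitByHead x L)
  splitByHead x ((y ∷ w) ∷ L) with y F.≟ x
  ... | yes _ = map₁ (w ∷_) (splitByHead x L)
  ... | no _ = map₂ ((y ∷ w) ∷_) (splitByHead x L)

  DoesNotStartWith : Fin k → List (Fin k) → Set
  DoesNotStartWith x [] = ⊤
  DoesNotStartWith x (y ∷ _) = y ≢ x

  length-splitByHead : ∀ (x : Fin k) L →
    length L ≡ length (proj₁ (splitByHead x L)) + length (proj₂ (splitByHead x L))
  length-splitByHead x [] = refl
  length-splitByHead x ([] ∷ L) = trans (cong suc (length-splitByHead x L)) (sym (+-suc _ _))
  length-splitByHead x ((y ∷ w) ∷ L) with y F.≟ x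
  ... | yes _ = cong suc (length-splitByHead x L)
  ... | no _ = trans (cong suc (length-splitByHead x L)) (sym (+-suc _ _))

  ∈-splitByHead₁ : ∀ (x : Fin k) L {v} → v ∈ proj₁ (splitByHead x L) → (x ∷ v) ∈ L
  ∈-splitByHead₁ x ([] ∷ L) v∈ = there (∈-splitByHead₁ x L v∈)
  ∈-splitByHead₁ x ((y ∷ w) ∷ L) v∈ with y F.≟ x
  ∈-splitByHead₁ x ((y ∷ w) ∷ L) (here refl) | yes refl = here refl
  ∈-splitByHead₁ x ((y ∷ w) ∷ L) (there v∈) | yes refl = there (∈-splitByHead₁ x L v∈)
  ... | no _ = there (∈-splitByHead₁ x L v∈)

  ∈-splitByHead₂ : ∀ (x : Fin k) L {v} → v ∈ proj₂ (splitByHead x L) → v ∈ L × DoesNotStartWith x v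
  ∈-splitByHead₂ x ([] ∷ L) (here refl) = here refl , tt
  ∈-splitByHead₂ x ([] ∷ L) (there v∈) = map₁ there (∈-splitByHead₂ x L v∈)
  ∈-splitByHead₂ x ((y ∷ w) ∷ L) v∈ with y F.≟ x
  ... | yes _ = map₁ there (∈-splitByHead₂ x L v∈)
  ∈-splitByHead₂ x ((y ∷ w) ∷ L) (here refl) | no y≢x = here refl , y≢x
  ∈-splitByHead₂ x ((y ∷ w) ∷ L) (there v∈) | no _ = map₁ there (∈-splitByHead₂ x L v∈)

  unique-splitByHead₁ : ∀ (x : Fin k) L → Unique L → Unique (proj₁ (splitByHead x L))
  unique-splitByHead₁ x [] _ = []
  unique-splitByHead₁ x ([] ∷ L) (_ ∷ u) = unique-splitByHead₁ x L u
  unique-splitByHead₁ x ((y ∷ w) ∷ L) (w≢ ∷ u) with y F.≟ x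
  ... | yes refl = All.tabulate (λ v∈ w≡v → All.lookup w≢ (∈-splitByHead₁ x L v∈) (cong (x ∷_) w≡v)) ∷ unique-splitByHead₁ x L u
  ... | no _ = unique-splitByHead₁ x L u

  unique-splitByHead₂ : ∀ (x : Fin k) L → Unique L → Unique (proj₂ (splitByHead x L))
  unique-splitByHead₂ x [] _ = []
  unique-splitByHead₂ x ([] ∷ L) (w≢ ∷ u) = All.tabulate (λ v∈ → All.lookup w≢ (proj₁ (∈-splitByHead₂ x L v∈))) ∷ unique-splitByHead₂ x L u
  unique-splitByHead₂ x ((y ∷ w) ∷ L) (w≢ ∷ u) with y F.≟ x
  ... | yes _ = unique-splitByHead₂ x L u
  ... | no _ = All.tabulate (λ v∈ → All.lookup w≢ (proj₁ (∈-splitByHead₂ x L v∈))) ∷ unique-splitByHead₂ x L u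

  arrangement-tail : ∀ {x : Fin k} {σ A v} → (x ∷ v) ⊆ (x ∷ σ) × Arrangement A (x ∷ v) → v ⊆ σ × Arrangement (remove x A) v
  arrangement-tail {x = x} {σ} {A} {v} (xv⊆xσ , (x∉v ∷ u) , ∈⇒A , A⇒∈) = tail⊆ xv⊆xσ , u , ∈⇒remove , remove⇒∈
    where
      tail⊆ : (x ∷ v) ⊆ (x ∷ σ) → v ⊆ σ
      tail⊆ (_ ∷ʳ xv⊆σ) = ∷ˡ⁻ xv⊆σ
      tail⊆ (_ ∷ v⊆σ) = v⊆σ
      ∈⇒remove : ∀ m → m ∈ v → remove x A m ≡ true
      ∈⇒remove m m∈v = trans (remove-≢ x A λ m≡x → All.lookup x∉v m∈v (sym m≡x)) (∈⇒A m (there m∈v))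
      remove⇒∈ : ∀ m → remove x A m ≡ true → m ∈ v
      remove⇒∈ m h with remove-true x A m h
      ... | m≢x , Am with A⇒∈ m Am
      ... | here m≡x = ⊥-elim (m≢x m≡x)
      ... | there m∈v = m∈v

  ⊆-∷-skip : ∀ {x : Fin k} {σ v} → DoesNotStartWith x v → v ⊆ (x ∷ σ) → v ⊆ σ
  ⊆-∷-skip {v = []} _ _ = minimum _
  ⊆-∷-skip {v = _ ∷ _} _ (_ ∷ʳ v⊆σ) = v⊆σ
  ⊆-∷-skip {v = _ ∷ _} y≢x (refl ∷ _) = ⊥-elim (y≢x refl)

  startingWith : ∀ (x : Fin k) {σ A} L → All (λ w → w ⊆ (x ∷ σ) × Arrangement A w) L →
    All (λ w → w ⊆ σ × Arrangement (remove x A) w) (proj₁ (splitByHead x L))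
  startingWith x L all⊆ = All.tabulate λ v∈ → arrangement-tail (All.lookup all⊆ (∈-splitByHead₁ x L v∈))

  notStartingWith : ∀ (x : Fin k) {σ A} L → All (λ w → w ⊆ (x ∷ σ) × Arrangement A w) L →
    All (λ w → w ⊆ σ × Arrangement A w) (proj₂ (splitByHead x L))
  notStartingWith x L all⊆ = All.tabulate λ v∈ →
    let (v∈L , ¬x) = ∈-splitByHead₂ x L v∈ ; (v⊆ , arr) = All.lookup all⊆ v∈L in ⊆-∷-skip ¬x v⊆ , arr

  -- Induction on σ: an arrangement inside x ∷ σ either uses this x first (then its tail
  -- arranges A without x inside σ) or lies inside σ.
  #arrangements≤weight : ∀ (σ : List (Fin k)) A (L : Words k) → Unique L →
    All (λ w → w ⊆ σ × Arrangement A w) L → length L ≤ weight A σ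
  #arrangements≤weight [] A [] _ _ = z≤n
  #arrangements≤weight [] A (_ ∷ []) _ (([] , _ , _ , A⇒∈) ∷ []) =
    ≤-reflexive (sym (weight-[] A λ m Am → ∉[] (A⇒∈ m Am)))
    where ∉[] : ∀ {m : Fin _} → m ∈ [] → ⊥
          ∉[] ()
  #arrangements≤weight [] A (_ ∷ _ ∷ _) ((≢[] ∷ _) ∷ _) (([] , _) ∷ ([] , _) ∷ _) = ⊥-elim (≢[] refl)
  #arrangements≤weight (x ∷ σ) A L u all⊆ with A x in Ax
  ... | true = begin
      length L ≡⟨ length-splitByHead x L ⟩
      length (proj₁ (splitByHead x L)) + length (proj₂ (splitByHead x L))
        ≤⟨ +-mono-≤ (#arrangements≤weight σ (remove x A) _ (unique-splitByHead₁ x L u) (startingWith x L all⊆))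
                    (#arrangements≤weight σ A _ (unique-splitByHead₂ x L u) (notStartingWith x L all⊆)) ⟩
      weight (remove x A) σ + weight A σ ≡⟨ weight-∷-true x σ Ax ⟩
      weight A (x ∷ σ) ∎
    where open ≤-Reasoning
  ... | false = begin
      length L ≡⟨ length-splitByHead x L ⟩
      length (proj₁ (splitByHead x L)) + length (proj₂ (splitByHead x L))
        ≡⟨ cong (_+ length (proj₂ (splitByHead x L))) (empty _ λ v∈ → x∉ (All.lookup all⊆ (∈-splitByHead₁ x L v∈))) ⟩
      length (proj₂ (splitByHead x L)) ≤⟨ #arrangements≤weight σ A _ (unique-splitByHead₂ x L u) (notStartingWith x L all⊆) ⟩
      weight A σ ≡⟨ weight-∷-false x σ Ax ⟩
      weight A (x ∷ σ) ∎
    where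
      open ≤-Reasoning
      empty : ∀ {B : Set} (ws : List B) → (∀ {v} → v ∈ ws → ⊥) → length ws ≡ 0
      empty [] _ = refl
      empty (_ ∷ _) ∉ws = ⊥-elim (∉ws (here refl))
      x∉ : ∀ {v} → (x ∷ v) ⊆ (x ∷ σ) × Arrangement A (x ∷ v) → ⊥
      x∉ (_ , _ , ∈⇒A , _) with trans (sym Ax) (∈⇒A x (here refl))
      ... | ()

module Patterns where
  open import Data.Nat as ℕ using (ℕ; zero; suc; _≤_)
  import Data.Nat.Properties as ℕP
  open import Data.Fin as F using (Fin; zero; suc; toℕ; punchOut)
  open import Data.Fin.Properties using (any?; injective⇒≤; punchOut-injective; punchIn-punchOut; suc-injective; <-cmp; <-irrefl)
  open import Data.Vec as V using (Vec; lookup; toList)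
  open import Data.Vec.Properties using (tabulate∘lookup; tabulate-cong)
  open import Data.List as L using (List; []; _∷_; length; tabulate)
  open import Data.List.Properties using (∷-injective) renaming (tabulate-cong to tabulate-congₗ)
  open import Data.List.Relation.Unary.All as All using (All; []; _∷_; reduce)
  open import Data.List.Relation.Unary.Unique.Propositional using (Unique)
  open import Data.List.Relation.Unary.AllPairs using ([]; _∷_)
  open import Data.List.Relation.Unary.Unique.Propositional.Properties using (tabulate⁺)
  open import Data.List.Membership.Propositional using (_∈_)
  open import Data.List.Membership.Propositional.Properties using (∈-tabulate⁺)
  open import Data.List.Relation.Binary.Sublist.Propositional using (_⊆_; _∷_; _∷ʳ_; minimum)
  open import Data.Bool using (true)
  open import Data.Product using (_×_; _,_; proj₁; proj₂; ∃)
  open import Data.Empty using (⊥-elim)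
  open import Relation.Nullary using (yes; no)
  open import Relation.Binary.PropositionalEquality
  open import Relation.Binary.Definitions using (tri<; tri≈; tri>)
  open import Function using (_∘_)
  open import Function.Bundles using (Equivalence)
  open import Function.Definitions using (Injective)
  open Arrangements

  private
    variable
      k n : ℕ

  StrictlyIncreasing : (Fin k → Fin n) → Set
  StrictlyIncreasing {k} t = ∀ (i j : Fin k) → i F.< j → t i F.< t j

  lower : (t : Fin k → Fin (suc n)) → (∀ i → zero ≢ t i) → Fin k → Fin n
  lower t 0∉t i = punchOut (0∉t i)

  suc∘lower : ∀ (t : Fin k → Fin (suc n)) 0∉t i → suc (lower t 0∉t i) ≡ t i
  suc∘lower t 0∉t i = punchIn-punchOut (0∉t i)

  lower-increasing : ∀ (t : Fin k → Fin (suc n)) 0∉t → StrictlyIncreasing t → StrictlyIncreasing (lower t 0∉t)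
  lower-increasing t 0∉t t↑ i j i<j =
    ℕP.≤-pred (subst₂ F._<_ (sym (suc∘lower t 0∉t i)) (sym (suc∘lower t 0∉t j)) (t↑ i j i<j))

  above⇒≢0 : ∀ {a b : Fin (suc n)} → a F.< b → zero ≢ b
  above⇒≢0 a<b refl = ℕP.n≮0 a<b

  select-⊆ : ∀ {A : Set} (σ : Vec A n) (t : Fin k → Fin n) → StrictlyIncreasing t →
             tabulate (lookup σ ∘ t) ⊆ toList σ
  select-⊆ {k = zero} σ t _ = minimum _
  select-⊆ {k = suc k} V.[] t _ with t zero
  ... | ()
  select-⊆ {k = suc k} (y V.∷ σ) t t↑ with t zero in t0≡
  ... | zero = refl ∷ subst (_⊆ toList σ) (sym tails≡) (select-⊆ σ (lower t′ 0∉t′) (lower-increasing t′ 0∉t′ t′↑))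
    where
      t′ : Fin k → Fin (suc _)
      t′ = t ∘ suc
      t′↑ : StrictlyIncreasing t′
      t′↑ i j i<j = t↑ (suc i) (suc j) (ℕ.s≤s i<j)
      0∉t′ : ∀ i → zero ≢ t′ i
      0∉t′ i = above⇒≢0 (subst (F._< t (suc i)) t0≡ (t↑ zero (suc i) (ℕ.s≤s ℕ.z≤n)))
      tails≡ : tabulate (lookup (y V.∷ σ) ∘ t′) ≡ tabulate (lookup σ ∘ lower t′ 0∉t′)
      tails≡ = tabulate-congₗ (λ i → cong (lookup (y V.∷ σ)) (sym (suc∘lower t′ 0∉t′ i)))
  ... | suc z = y ∷ʳ subst (_⊆ toList σ) all≡ (select-⊆ σ (lower t 0∉t) (lower-increasing t 0∉t t↑))
    where
      0∉t : ∀ i → zero ≢ t i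
      0∉t zero 0≡t0 with trans 0≡t0 t0≡
      ... | ()
      0∉t (suc i) = above⇒≢0 (t↑ zero (suc i) (ℕ.s≤s ℕ.z≤n))
      all≡ : tabulate (lookup σ ∘ lower t 0∉t) ≡ lookup σ z ∷ tabulate (lookup (y V.∷ σ) ∘ t ∘ suc)
      all≡ = cong₂ _∷_ (cong (lookup σ) (suc-injective (trans (suc∘lower t 0∉t zero) t0≡)))
                       (tabulate-congₗ (λ i → cong (lookup (y V.∷ σ)) (suc∘lower t 0∉t (suc i))))

  injective⇒surjective : ∀ (f : Fin k → Fin k) → Injective _≡_ _≡_ f → ∀ m → ∃ λ i → f i ≡ m
  injective⇒surjective {suc k} f f-inj m with any? (λ i → f i F.≟ m)
  ... | yes hit = hit
  ... | no miss = ⊥-elim (ℕP.<-irrefl refl (injective⇒≤ {f = f′} f′-inj))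
    where
      m≢f : ∀ i → m ≢ f i
      m≢f i m≡fi = miss (i , sym m≡fi)
      f′ : Fin (suc k) → Fin k
      f′ i = punchOut (m≢f i)
      f′-inj : Injective _≡_ _≡_ f′
      f′-inj {i} {j} e = f-inj (punchOut-injective (m≢f i) (m≢f j) e)

  -- Two permutations of Fin k inducing the same order agree at i, by induction on f i: were
  -- f′ i ≠ f i, the j with f j = f′ i (or f′ j = f i) has a smaller f-value, so f′ j = f j,
  -- contradicting injectivity or the order.
  module _ (f f′ : Fin k → Fin k) (f-inj : Injective _≡_ _≡_ f) (f′-inj : Injective _≡_ _≡_ f′)
           (f⇒f′ : ∀ i j → f i F.< f j → f′ i F.< f′ j) (f′⇒f : ∀ i j → f′ i F.< f′ j → f i F.< f j) where

    private
      agree-below : ∀ b i → toℕ (f i) ℕ.< b → f′ i ≡ f i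
      agree-below (suc b) i fi<1+b with <-cmp (f′ i) (f i)
      ... | tri≈ _ f′i≡fi _ = f′i≡fi
      ... | tri< f′i<fi _ _ = ⊥-elim (<-irrefl (sym fi≡f′i) f′i<fi)
        where
          j = proj₁ (injective⇒surjective f f-inj (f′ i))
          fj≡f′i = proj₂ (injective⇒surjective f f-inj (f′ i))
          j≡i : j ≡ i
          j≡i = f′-inj (trans (agree-below b j (ℕP.<-≤-trans (subst (F._< f i) (sym fj≡f′i) f′i<fi) (ℕP.≤-pred fi<1+b))) fj≡f′i)
          fi≡f′i : f i ≡ f′ i
          fi≡f′i = trans (cong f (sym j≡i)) fj≡f′i
      ... | tri> _ _ fi<f′i = ⊥-elim (<-irrefl (trans (sym (agree-below b j (ℕP.<-≤-trans fj<fi (ℕP.≤-pred fi<1+b)))) f′j≡fi) fj<fi)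
        where
          j = proj₁ (injective⇒surjective f′ f′-inj (f i))
          f′j≡fi = proj₂ (injective⇒surjective f′ f′-inj (f i))
          fj<fi : f j F.< f i
          fj<fi = f′⇒f j i (subst (F._< f′ i) (sym f′j≡fi) fi<f′i)

    order-equivalent⇒≗ : ∀ i → f′ i ≡ f i
    order-equivalent⇒≗ i = agree-below (suc (toℕ (f i))) i ℕP.≤-refl

  tabulate-injective : ∀ {A : Set} (f g : Fin k → A) → tabulate f ≡ tabulate g → ∀ i → f i ≡ g i
  tabulate-injective {suc k} f g e zero = proj₁ (∷-injective e)
  tabulate-injective {suc k} f g e (suc i) = tabulate-injective (f ∘ suc) (g ∘ suc) (proj₂ (∷-injective e)) i

  module _ (σ : Vec (Fin k) n) where

    record ContainedPerm (π : Vec (Fin k) k) : Set where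
      constructor containedPerm
      field
        isPerm : IsPerm π
        contains : Contains σ π

    word : ∀ {π} → ContainedPerm π → List (Fin k)
    word (containedPerm _ (t , _)) = tabulate (lookup σ ∘ t)

    occurrence-injective : ∀ {π} ((containedPerm _ (t , _)) : ContainedPerm π) → Injective _≡_ _≡_ (lookup σ ∘ t)
    occurrence-injective {π} (containedPerm π-perm (t , _ , t≈π)) {i} {j} σti≡σtj with <-cmp (lookup π i) (lookup π j)
    ... | tri≈ _ πi≡πj _ = π-perm πi≡πj
    ... | tri< πi<πj _ _ = ⊥-elim (<-irrefl σti≡σtj (Equivalence.from (t≈π i j) πi<πj))
    ... | tri> _ _ πj<πi = ⊥-elim (<-irrefl (sym σti≡σtj) (Equivalence.from (t≈π j i) πj<πi))

    word-arrangement : ∀ {π} (pc : ContainedPerm π) → Arrangement (λ _ → true) (word pc)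
    word-arrangement pc@(containedPerm _ (t , _)) = tabulate⁺ (occurrence-injective pc) , (λ _ _ → refl) , λ m _ →
      let (i , σti≡m) = injective⇒surjective (lookup σ ∘ t) (occurrence-injective pc) m
      in subst (_∈ word pc) σti≡m (∈-tabulate⁺ {f = lookup σ ∘ t} i)

    word-injective : ∀ {π π′} (pc : ContainedPerm π) (pc′ : ContainedPerm π′) → word pc ≡ word pc′ → π ≡ π′
    word-injective {π} {π′} (containedPerm π-perm (t , _ , t≈π)) (containedPerm π′-perm (t′ , _ , t′≈π′)) words≡ = begin
        π ≡⟨ tabulate∘lookup π ⟨
        V.tabulate (lookup π) ≡⟨ tabulate-cong (λ i → sym (order-equivalent⇒≗ (lookup π) (lookup π′) π-perm π′-perm π⇒π′ π′⇒π i)) ⟩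
        V.tabulate (lookup π′) ≡⟨ tabulate∘lookup π′ ⟩
        π′ ∎
      where
        open ≡-Reasoning
        σt≗σt′ : ∀ i → lookup σ (t i) ≡ lookup σ (t′ i)
        σt≗σt′ = tabulate-injective _ _ words≡
        π⇒π′ : ∀ i j → lookup π i F.< lookup π j → lookup π′ i F.< lookup π′ j
        π⇒π′ i j πi<πj = Equivalence.to (t′≈π′ i j) (subst₂ F._<_ (σt≗σt′ i) (σt≗σt′ j) (Equivalence.from (t≈π i j) πi<πj))
        π′⇒π : ∀ i j → lookup π′ i F.< lookup π′ j → lookup π i F.< lookup π j
        π′⇒π i j π′i<π′j = Equivalence.to (t≈π i j) (subst₂ F._<_ (sym (σt≗σt′ i)) (sym (σt≗σt′ j)) (Equivalence.from (t′≈π′ i j) π′i<π′j))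

    words : ∀ {πs} → All ContainedPerm πs → List (List (Fin k))
    words = reduce word

    length-words : ∀ {πs} (pcs : All ContainedPerm πs) → length (words pcs) ≡ length πs
    length-words [] = refl
    length-words (_ ∷ pcs) = cong suc (length-words pcs)

    words-⊆-arrangements : ∀ {πs} (pcs : All ContainedPerm πs) →
      All (λ w → w ⊆ toList σ × Arrangement (λ _ → true) w) (words pcs)
    words-⊆-arrangements [] = []
    words-⊆-arrangements (pc@(containedPerm _ (t , t↑ , _)) ∷ pcs) = (select-⊆ σ t t↑ , word-arrangement pc) ∷ words-⊆-arrangements pcs

    unique-words : ∀ {πs} (pcs : All ContainedPerm πs) → Unique πs → Unique (words pcs)
    unique-words [] [] = []
    unique-words {π ∷ _} (pc ∷ pcs) (π∉ ∷ u) = distinct pcs π∉ ∷ unique-words pcs u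
      where
        distinct : ∀ {πs} (pcs : All ContainedPerm πs) → All (π ≢_) πs → All (word pc ≢_) (words pcs)
        distinct [] [] = []
        distinct (pc′ ∷ pcs) (π≢ ∷ π≢s) = (λ words≡ → π≢ (word-injective pc pc′ words≡)) ∷ distinct pcs π≢s

    #patterns≤∏occurrences : ∀ πs → Unique πs → (pcs : All ContainedPerm πs) →
      length πs ≤ ∏ (occurrences (toList σ))
    #patterns≤∏occurrences πs u pcs = subst (_≤ ∏ (occurrences (toList σ))) (length-words pcs)
      (#arrangements≤weight (toList σ) (λ _ → true) (words pcs) (unique-words pcs u) (words-⊆-arrangements pcs))

module SymbolCounts where
  open import Data.Nat as ℕ using (ℕ; zero; suc; _+_; _*_; _^_; _≤_; _<_)
  open import Data.Nat.Properties hiding (suc-injective)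
  open import Data.Fin as F using (Fin; zero; suc)
  open import Data.Fin.Properties using (suc-injective)
  open import Data.Vec as V using (Vec; toList)
  open import Data.Vec.Properties using (length-toList)
  open import Data.Vec.Functional using (tail)
  open import Data.List as L using (List; []; _∷_; _++_; length; filter; map; allFin)
  open import Data.List.Properties using (length-++; length-tabulate; length-map; map-++; map-tabulate)
  open import Data.Nat.ListAction using (sum; product)
  open import Data.Nat.ListAction.Properties using (sum-++; product-++; sum-↭; product-↭)
  open import Data.List.Relation.Binary.Permutation.Propositional using (_↭_; ↭-refl; prep; ↭-trans)
  open import Data.List.Relation.Binary.Permutation.Propositional.Properties using (shift; ↭-length; map⁺)
  open import Data.List.Relation.Unary.All as All using (All; []; _∷_)
  open import Data.List.Relation.Unary.All.Properties using (all-filter)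
  open import Relation.Nullary using (yes; no)
  open import Relation.Unary using (Pred; Decidable)
  open import Relation.Unary.Properties using (∁?)
  open import Relation.Binary.PropositionalEquality
  open import Algebra.Properties.CommutativeSemigroup *-commutativeSemigroup using (interchange)
  open import Function using (_∘_; id)
  open import Level using (0ℓ)
  open Arrangements using (∏; occurrences; occurrences-here; occurrences-there)
  open PowerBounds using (amgm)

  module _ {A : Set} {P : Pred A 0ℓ} (P? : Decidable P) where

    filter++filter∁↭ : ∀ xs → filter P? xs ++ filter (∁? P?) xs ↭ xs
    filter++filter∁↭ [] = ↭-refl
    filter++filter∁↭ (x ∷ xs) with P? x
    ... | yes _ = prep x (filter++filter∁↭ xs)
    ... | no _ = ↭-trans (shift x (filter P? xs) (filter (∁? P?) xs)) (prep x (filter++filter∁↭ xs))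

    length-filter+length-filter∁ : ∀ xs → length (filter P? xs) + length (filter (∁? P?) xs) ≡ length xs
    length-filter+length-filter∁ xs = trans (sym (length-++ (filter P? xs))) (↭-length (filter++filter∁↭ xs))

    product-filter*product-filter∁ : ∀ (f : A → ℕ) xs →
      product (map f (filter P? xs)) * product (map f (filter (∁? P?) xs)) ≡ product (map f xs)
    product-filter*product-filter∁ f xs = begin
      product (map f (filter P? xs)) * product (map f (filter (∁? P?) xs)) ≡⟨ product-++ (map f (filter P? xs)) _ ⟨
      product (map f (filter P? xs) ++ map f (filter (∁? P?) xs)) ≡⟨ cong product (map-++ f (filter P? xs) _) ⟨
      product (map f (filter P? xs ++ filter (∁? P?) xs)) ≡⟨ product-↭ (map⁺ f (filter++filter∁↭ xs)) ⟩
      product (map f xs) ∎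
      where open ≡-Reasoning

    sum-filter≤sum : ∀ (f : A → ℕ) xs → sum (map f (filter P? xs)) ≤ sum (map f xs)
    sum-filter≤sum f xs = begin
      sum (map f (filter P? xs)) ≤⟨ m≤m+n _ _ ⟩
      sum (map f (filter P? xs)) + sum (map f (filter (∁? P?) xs)) ≡⟨ sum-++ (map f (filter P? xs)) _ ⟨
      sum (map f (filter P? xs) ++ map f (filter (∁? P?) xs)) ≡⟨ cong sum (map-++ f (filter P? xs) _) ⟨
      sum (map f (filter P? xs ++ filter (∁? P?) xs)) ≡⟨ sum-↭ (map⁺ f (filter++filter∁↭ xs)) ⟩
      sum (map f xs) ∎
      where open ≤-Reasoning

  10^d*product≤k^d : ∀ {A : Set} (f : A → ℕ) k xs → All (λ m → 10 * f m ≤ k) xs →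
    10 ^ length xs * product (map f xs) ≤ k ^ length xs
  10^d*product≤k^d f k [] [] = ≤-refl
  10^d*product≤k^d f k (x ∷ xs) (10fx≤k ∷ rest) = begin
    10 * 10 ^ length xs * (f x * product (map f xs)) ≡⟨ interchange 10 (10 ^ length xs) (f x) _ ⟩
    (10 * f x) * (10 ^ length xs * product (map f xs)) ≤⟨ *-mono-≤ 10fx≤k (10^d*product≤k^d f k xs rest) ⟩
    k * k ^ length xs ∎
    where open ≤-Reasoning

  ∑ : ∀ {k} → (Fin k → ℕ) → ℕ
  ∑ {zero} f = 0
  ∑ {suc k} f = f zero + ∑ (tail f)

  ∑-cong : ∀ {k} {f g : Fin k → ℕ} → (∀ i → f i ≡ g i) → ∑ f ≡ ∑ g
  ∑-cong {zero} _ = refl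
  ∑-cong {suc k} f≗g = cong₂ _+_ (f≗g zero) (∑-cong (f≗g ∘ suc))

  ∑-zeros : ∀ {k} (f : Fin k → ℕ) → (∀ i → f i ≡ 0) → ∑ f ≡ 0
  ∑-zeros {zero} f _ = refl
  ∑-zeros {suc k} f f≗0 rewrite f≗0 zero = ∑-zeros (tail f) (f≗0 ∘ suc)

  ∑-suc-at : ∀ {k} (x : Fin k) (g h : Fin k → ℕ) → h x ≡ suc (g x) → (∀ m → m ≢ x → h m ≡ g m) → ∑ h ≡ suc (∑ g)
  ∑-suc-at zero g h hx h≈g = cong₂ _+_ hx (∑-cong λ i → h≈g (suc i) λ ())
  ∑-suc-at (suc x) g h hx h≈g = trans
    (cong₂ _+_ (h≈g zero λ ()) (∑-suc-at x (tail g) (tail h) hx λ m m≢x → h≈g (suc m) (m≢x ∘ suc-injective)))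
    (+-suc _ _)

  ∑-occurrences : ∀ {k} (σ : List (Fin k)) → ∑ (occurrences σ) ≡ length σ
  ∑-occurrences {k} [] = ∑-zeros {k} (occurrences []) λ _ → refl
  ∑-occurrences (x ∷ σ) = trans
    (∑-suc-at x (occurrences σ) (occurrences (x ∷ σ)) (occurrences-here x σ) λ m m≢x → occurrences-there σ (m≢x ∘ sym))
    (cong suc (∑-occurrences σ))

  map-allFin-suc : ∀ {k} (f : Fin (suc k) → ℕ) → map f (L.tabulate suc) ≡ map (tail f) (allFin k)
  map-allFin-suc f = trans (map-tabulate suc f) (sym (map-tabulate id (tail f)))

  sum-allFin : ∀ {k} (f : Fin k → ℕ) → sum (map f (allFin k)) ≡ ∑ f
  sum-allFin {zero} f = refl
  sum-allFin {suc k} f = cong (f zero +_) (trans (cong sum (map-allFin-suc f)) (sum-allFin (tail f)))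

  product-allFin : ∀ {k} (f : Fin k → ℕ) → product (map f (allFin k)) ≡ ∏ f
  product-allFin {zero} f = refl
  product-allFin {suc k} f = cong (f zero *_) (trans (cong product (map-allFin-suc f)) (product-allFin (tail f)))

  module _ {k n : ℕ} (σ : Vec (Fin k) n) where

    common? : Decidable (λ m → k < 10 * occ σ m)
    common? m = k ℕ.<? 10 * occ σ m

    numRare : ℕ
    numRare = length (filter (∁? common?) (allFin k))

    numCommon+numRare≡k : numCommon σ + numRare ≡ k
    numCommon+numRare≡k = trans (length-filter+length-filter∁ common? (allFin k)) (length-tabulate id)

    -- AM-GM on the common symbols (their counts sum to at most n), and a_m ≤ k/10 on the rare ones.
    c^c*10^d*∏occurrences≤n^c*k^d : let c = numCommon σ ; d = numRare in
      c ^ c * 10 ^ d * ∏ (occurrences (toList σ)) ≤ n ^ c * k ^ d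
    c^c*10^d*∏occurrences≤n^c*k^d = begin
        c ^ c * 10 ^ d * ∏ (occ σ) ≡⟨ cong (c ^ c * 10 ^ d *_) ∏≡product ⟩
        c ^ c * 10 ^ d * (product (map (occ σ) common) * product (map (occ σ) rare))
          ≡⟨ interchange (c ^ c) (10 ^ d) _ _ ⟩
        (c ^ c * product (map (occ σ) common)) * (10 ^ d * product (map (occ σ) rare))
          ≤⟨ *-mono-≤ (≤-trans amgm-common (^-monoˡ-≤ c ∑common≤n))
                      (10^d*product≤k^d (occ σ) k rare (All.map ≮⇒≥ (all-filter (∁? common?) (allFin k)))) ⟩
        n ^ c * k ^ d ∎
      where
        open ≤-Reasoning
        c = numCommon σ
        d = numRare
        common = filter common? (allFin k)
        rare = filter (∁? common?) (allFin k)
        ∏≡product : ∏ (occ σ) ≡ product (map (occ σ) common) * product (map (occ σ) rare)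
        ∏≡product = trans (sym (product-allFin (occ σ))) (sym (product-filter*product-filter∁ common? (occ σ) (allFin k)))
        ∑common≤n : sum (map (occ σ) common) ≤ n
        ∑common≤n = ≤-trans (sum-filter≤sum common? (occ σ) (allFin k))
          (≤-reflexive (trans (sum-allFin (occ σ)) (trans (∑-occurrences (toList σ)) (length-toList σ))))
        amgm-common : c ^ c * product (map (occ σ) common) ≤ sum (map (occ σ) common) ^ c
        amgm-common = subst (λ z → z ^ z * product (map (occ σ) common) ≤ sum (map (occ σ) common) ^ z)
          (length-map (occ σ) common) (amgm (map (occ σ) common))

module NatEmbedding where
  open import Data.Nat as ℕ using (ℕ; suc)
  open import Data.Integer as ℤ using (+_)
  import Data.Integer.Properties as ℤP
  open import Data.Rational as Q using (ℚ; mkℚ; 0ℚ; 1ℚ; _+_; _*_; _≤_; _<_)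
  import Data.Rational.Properties as QP
  import Data.Rational.Unnormalised as U
  import Data.Rational.Unnormalised.Properties as UP
  open import Data.Nat.Coprimality using (1-coprimeTo; sym)
  open import Relation.Binary.PropositionalEquality hiding (sym)
  import Relation.Binary.PropositionalEquality as ≡

  -- ℕ → ℚ in normal form, so that its arithmetic reduces on the numerator alone.
  ι : ℕ → ℚ
  ι m = mkℚ (+ m) 0 (sym (1-coprimeTo m))

  ι≡ℕtoℚ : ∀ m → ℕtoℚ m ≡ ι m
  ι≡ℕtoℚ m = QP.normalize-coprime (sym (1-coprimeTo m))

  ι-+ : ∀ a b → ι (a ℕ.+ b) ≡ ι a + ι b
  ι-+ a b = QP.toℚᵘ-injective (UP.≃-trans (U.*≡* numerators) (UP.≃-sym (QP.toℚᵘ-homo-+ (ι a) (ι b))))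
    where
      open ≡-Reasoning
      numerators : + (a ℕ.+ b) ℤ.* + 1 ≡ (+ a ℤ.* + 1 ℤ.+ + b ℤ.* + 1) ℤ.* + 1
      numerators = begin
        + (a ℕ.+ b) ℤ.* + 1 ≡⟨ ℤP.*-identityʳ _ ⟩
        + (a ℕ.+ b) ≡⟨ ℤP.pos-+ a b ⟩
        + a ℤ.+ + b ≡⟨ cong₂ ℤ._+_ (ℤP.*-identityʳ (+ a)) (ℤP.*-identityʳ (+ b)) ⟨
        + a ℤ.* + 1 ℤ.+ + b ℤ.* + 1 ≡⟨ ℤP.*-identityʳ _ ⟨
        (+ a ℤ.* + 1 ℤ.+ + b ℤ.* + 1) ℤ.* + 1 ∎

  ι-* : ∀ a b → ι (a ℕ.* b) ≡ ι a * ι b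
  ι-* a b = QP.toℚᵘ-injective (UP.≃-trans (U.*≡* numerators) (UP.≃-sym (QP.toℚᵘ-homo-* (ι a) (ι b))))
    where
      numerators : + (a ℕ.* b) ℤ.* + 1 ≡ (+ a ℤ.* + b) ℤ.* + 1
      numerators = trans (ℤP.*-identityʳ _) (trans (ℤP.pos-* a b) (≡.sym (ℤP.*-identityʳ _)))

  ι-mono-≤ : ∀ {a b} → a ℕ.≤ b → ι a ≤ ι b
  ι-mono-≤ {a} {b} a≤b = Q.*≤* (subst₂ ℤ._≤_ (≡.sym (ℤP.*-identityʳ (+ a))) (≡.sym (ℤP.*-identityʳ (+ b))) (ℤ.+≤+ a≤b))

  ι-cancel-≤ : ∀ {a b} → ι a ≤ ι b → a ℕ.≤ b
  ι-cancel-≤ {a} {b} (Q.*≤* ιa≤ιb) = ℤP.drop‿+≤+ (subst₂ ℤ._≤_ (ℤP.*-identityʳ (+ a)) (ℤP.*-identityʳ (+ b)) ιa≤ιb)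

  ι-mono-< : ∀ {a b} → a ℕ.< b → ι a < ι b
  ι-mono-< {a} {b} a<b = Q.*<* (subst₂ ℤ._<_ (≡.sym (ℤP.*-identityʳ (+ a))) (≡.sym (ℤP.*-identityʳ (+ b))) (ℤ.+<+ a<b))

  ι-cancel-< : ∀ {a b} → ι a < ι b → a ℕ.< b
  ι-cancel-< {a} {b} (Q.*<* ιa<ιb) = ℤP.drop‿+<+ (subst₂ ℤ._<_ (ℤP.*-identityʳ (+ a)) (ℤP.*-identityʳ (+ b)) ιa<ιb)

  0≤ι : ∀ a → 0ℚ ≤ ι a
  0≤ι a = ι-mono-≤ ℕ.z≤n

  1/suc : ℕ → ℚ
  1/suc i = mkℚ (+ 1) i (1-coprimeTo (suc i))

  1/suc≡ : ∀ i → (+ 1) Q./ suc i ≡ 1/suc i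
  1/suc≡ i = QP.normalize-coprime (1-coprimeTo (suc i))

  1/suc*ι-suc : ∀ i → 1/suc i * ι (suc i) ≡ 1ℚ
  1/suc*ι-suc i = QP.toℚᵘ-injective (UP.≃-trans (QP.toℚᵘ-homo-* (1/suc i) (ι (suc i))) (U.*≡* numerators))
    where
      open ≡-Reasoning
      numerators : (+ 1 ℤ.* + suc i) ℤ.* + 1 ≡ + 1 ℤ.* + (suc i ℕ.* 1)
      numerators = begin
        (+ 1 ℤ.* + suc i) ℤ.* + 1 ≡⟨ ℤP.*-identityʳ _ ⟩
        + 1 ℤ.* + suc i ≡⟨ ℤP.*-identityˡ _ ⟩
        + suc i ≡⟨ cong +_ (ℕP.*-identityʳ (suc i)) ⟨
        + (suc i ℕ.* 1) ≡⟨ ℤP.*-identityˡ _ ⟨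
        + 1 ℤ.* + (suc i ℕ.* 1) ∎
        where import Data.Nat.Properties as ℕP

  0≤1/suc : ∀ i → 0ℚ ≤ (+ 1) Q./ suc i
  0≤1/suc i = subst (0ℚ ≤_) (≡.sym (1/suc≡ i)) (QP.nonNegative⁻¹ (1/suc i))

module ExpSeries where
  open import Data.Nat as ℕ using (ℕ; zero; suc; _!; _^_)
  import Data.Nat.Properties as ℕP
  open import Data.Integer using (+_)
  open import Data.Rational as Q using (0ℚ; 1ℚ; _+_; _*_; _≤_; _<_)
  import Data.Rational.Properties as QP
  open import Data.Rational.Solver using (module +-*-Solver)
  open import Data.Product using (_,_)
  open import Relation.Binary.PropositionalEquality
  open +-*-Solver
  open NatEmbedding

  expTerm-ι : ∀ a i → expTerm (ι a) i * ι (i !) ≡ ι (a ^ i)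
  expTerm-ι a zero = refl
  expTerm-ι a (suc i) = begin
      T * ι a * ((+ 1) Q./ suc i) * ι (suc i ℕ.* i !)
        ≡⟨ cong₂ (λ d m → T * ι a * d * m) (1/suc≡ i) (ι-* (suc i) (i !)) ⟩
      T * ι a * 1/suc i * (ι (suc i) * ι (i !)) ≡⟨ regroup T (ι a) (1/suc i) (ι (suc i)) (ι (i !)) ⟩
      (T * ι (i !)) * ι a * (1/suc i * ι (suc i)) ≡⟨ cong₂ (λ x y → x * ι a * y) (expTerm-ι a i) (1/suc*ι-suc i) ⟩
      ι (a ^ i) * ι a * 1ℚ ≡⟨ solve 2 (λ x A → x :* A :* con 1ℚ := A :* x) refl (ι (a ^ i)) (ι a) ⟩
      ι a * ι (a ^ i) ≡⟨ ι-* a (a ^ i) ⟨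
      ι (a ℕ.* a ^ i) ∎
    where
      open ≡-Reasoning
      T = expTerm (ι a) i
      regroup : ∀ T A d s f → T * A * d * (s * f) ≡ (T * f) * A * (d * s)
      regroup = solve 5 (λ T A d s f → T :* A :* d :* (s :* f) := (T :* f) :* A :* (d :* s)) refl

  *-monoʳ-≤-0≤ : ∀ {a b} c → 0ℚ ≤ c → a ≤ b → a * c ≤ b * c
  *-monoʳ-≤-0≤ c 0≤c = QP.*-monoʳ-≤-nonNeg c {{Q.nonNegative 0≤c}}

  *-monoˡ-≤-0≤ : ∀ {a b} c → 0ℚ ≤ c → a ≤ b → c * a ≤ c * b
  *-monoˡ-≤-0≤ c 0≤c = QP.*-monoˡ-≤-nonNeg c {{Q.nonNegative 0≤c}}

  *-mono-≤-0≤ : ∀ {a b c d} → 0ℚ ≤ a → 0ℚ ≤ c → a ≤ b → c ≤ d → a * c ≤ b * d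
  *-mono-≤-0≤ {b = b} {c} 0≤a 0≤c a≤b c≤d = QP.≤-trans (*-monoʳ-≤-0≤ c 0≤c a≤b) (*-monoˡ-≤-0≤ b (QP.≤-trans 0≤a a≤b) c≤d)

  0≤* : ∀ {a b} → 0ℚ ≤ a → 0ℚ ≤ b → 0ℚ ≤ a * b
  0≤* {a} {b} 0≤a 0≤b = subst (_≤ a * b) (QP.*-zeroˡ b) (*-monoʳ-≤-0≤ b 0≤b 0≤a)

  *-cancelʳ-≤-0< : ∀ {a b} c → 0ℚ < c → a * c ≤ b * c → a ≤ b
  *-cancelʳ-≤-0< c 0<c = QP.*-cancelʳ-≤-pos c {{Q.positive 0<c}}

  0<ι! : ∀ m → 0ℚ < ι (m !)
  0<ι! m = ι-mono-< (ℕP.1≤n! m)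

  0≤expTerm : ∀ x i → 0ℚ ≤ x → 0ℚ ≤ expTerm x i
  0≤expTerm x zero _ = QP.nonNegative⁻¹ 1ℚ
  0≤expTerm x (suc i) 0≤x = 0≤* (0≤* (0≤expTerm x i 0≤x) 0≤x) (0≤1/suc i)

  0≤expSum : ∀ x N → 0ℚ ≤ x → 0ℚ ≤ expSum x N
  0≤expSum x zero _ = QP.nonNegative⁻¹ 1ℚ
  0≤expSum x (suc N) 0≤x = QP.+-mono-≤ (0≤expSum x N 0≤x) (0≤expTerm x (suc N) 0≤x)

  expTerm-mono : ∀ {x y} i → 0ℚ ≤ x → x ≤ y → expTerm x i ≤ expTerm y i
  expTerm-mono zero _ _ = QP.≤-refl
  expTerm-mono {x} (suc i) 0≤x x≤y =
    *-monoʳ-≤-0≤ _ (0≤1/suc i) (*-mono-≤-0≤ (0≤expTerm x i 0≤x) 0≤x (expTerm-mono i 0≤x x≤y) x≤y)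

  expSum-monoˡ : ∀ {x y} N → 0ℚ ≤ x → x ≤ y → expSum x N ≤ expSum y N
  expSum-monoˡ zero _ _ = QP.≤-refl
  expSum-monoˡ (suc N) 0≤x x≤y = QP.+-mono-≤ (expSum-monoˡ N 0≤x x≤y) (expTerm-mono (suc N) 0≤x x≤y)

  expSum-monoʳ : ∀ x {N M} → 0ℚ ≤ x → N ℕ.≤ M → expSum x N ≤ expSum x M
  expSum-monoʳ x {N} 0≤x N≤M with ℕP.m≤n⇒∃[o]m+o≡n N≤M
  ... | o , refl = extend o
    where
      extend : ∀ o → expSum x N ≤ expSum x (N ℕ.+ o)
      extend zero = QP.≤-reflexive (cong (expSum x) (sym (ℕP.+-identityʳ N)))
      extend (suc o) = subst (λ z → expSum x N ≤ expSum x z) (sym (ℕP.+-suc N o))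
        (QP.≤-trans (extend o) (subst (_≤ expSum x (N ℕ.+ o) + expTerm x (suc (N ℕ.+ o))) (QP.+-identityʳ _)
          (QP.+-monoʳ-≤ (expSum x (N ℕ.+ o)) (0≤expTerm x (suc (N ℕ.+ o)) 0≤x))))

module Binomial where
  open import Data.Nat
  open import Data.Nat.Properties
  open import Relation.Binary.PropositionalEquality
  open import Data.Nat.Tactic.RingSolver
  open import Relation.Nullary using (yes; no)

  choose : ℕ → ℕ → ℕ
  choose n zero = 1
  choose zero (suc k) = 0
  choose (suc n) (suc k) = choose n k + choose n (suc k)

  choose-< : ∀ n k → n < k → choose n k ≡ 0
  choose-< zero (suc k) _ = refl
  choose-< (suc n) (suc k) (s≤s n<k) rewrite choose-< n k n<k | choose-< n (suc k) (m<n⇒m<1+n n<k) = refl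

  choose-n-n : ∀ n → choose n n ≡ 1
  choose-n-n zero = refl
  choose-n-n (suc n) rewrite choose-n-n n | choose-< n (suc n) (n<1+n n) = refl

  choose*!*!≡! : ∀ b c → choose (b + c) b * (b ! * c !) ≡ (b + c) !
  choose*!*!≡! zero c = trans (*-identityˡ _) (*-identityˡ _)
  choose*!*!≡! (suc b) zero rewrite +-identityʳ b | choose-n-n (suc b) = trans (+-identityʳ _) (*-identityʳ _)
  choose*!*!≡! (suc b) (suc c) = begin
      (X + Y) * ((suc b * b !) * (suc c * c !)) ≡⟨ distribute X Y b c (b !) (c !) ⟩
      suc b * (X * (b ! * (suc c * c !))) + suc c * (Y * ((suc b * b !) * c !))
        ≡⟨ cong₂ (λ p q → suc b * p + suc c * q) (choose*!*!≡! b (suc c)) Y*b!*c!≡ ⟩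
      suc b * (b + suc c) ! + suc c * (b + suc c) ! ≡⟨ *-distribʳ-+ ((b + suc c) !) (suc b) (suc c) ⟨
      (suc b + suc c) * (b + suc c) ! ∎
    where
      open ≡-Reasoning
      X = choose (b + suc c) b
      Y = choose (b + suc c) (suc b)
      Y*b!*c!≡ : Y * ((suc b * b !) * c !) ≡ (b + suc c) !
      Y*b!*c!≡ = subst (λ z → choose z (suc b) * ((suc b * b !) * c !) ≡ z !) (sym (+-suc b c)) (choose*!*!≡! (suc b) c)
      distribute : ∀ X Y b c x y → (X + Y) * ((suc b * x) * (suc c * y))
                                 ≡ suc b * (X * (x * (suc c * y))) + suc c * (Y * ((suc b * x) * y))
      distribute = solve-∀

  -- Σ_{b ≤ j} (i choose b) a^(i-b): the first j+1 terms of the binomial expansion of (a + 1)^i.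
  partialBinomial : ℕ → ℕ → ℕ → ℕ
  partialBinomial a i zero = a ^ i
  partialBinomial a i (suc j) = partialBinomial a i j + choose i (suc j) * a ^ (i ∸ suc j)

  choose-term-suc : ∀ a i b → choose (suc i) (suc b) * a ^ (suc i ∸ suc b)
                             ≡ a * (choose i (suc b) * a ^ (i ∸ suc b)) + choose i b * a ^ (i ∸ b)
  choose-term-suc a i b with suc b ≤? i
  ... | yes (s≤s b≤i′) rewrite +-∸-assoc 1 b≤i′ = distribute (choose i b) (choose i (suc b)) a (a ^ (i ∸ suc b))
    where distribute : ∀ p q a x → (p + q) * (a * x) ≡ a * (q * x) + p * (a * x)
          distribute = solve-∀
  ... | no b≮i rewrite choose-< i (suc b) (≰⇒> b≮i) = simplify (choose i b) a (a ^ (i ∸ b)) (a ^ (i ∸ suc b))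
    where simplify : ∀ p a x y → (p + 0) * x ≡ a * (0 * y) + p * x
          simplify = solve-∀

  partialBinomial-suc : ∀ a i j → partialBinomial a (suc i) (suc j) ≡ a * partialBinomial a i (suc j) + partialBinomial a i j
  partialBinomial-suc a i zero = begin
      a * a ^ i + (choose i 0 + choose i 1) * a ^ i ≡⟨ cong (a * a ^ i +_) (choose-term-suc a i 0) ⟩
      a * a ^ i + (a * (choose i 1 * a ^ (i ∸ 1)) + 1 * a ^ i) ≡⟨ regroup a (a ^ i) (choose i 1 * a ^ (i ∸ 1)) ⟩
      a * (a ^ i + choose i 1 * a ^ (i ∸ 1)) + a ^ i ∎
    where open ≡-Reasoning
          regroup : ∀ a x y → a * x + (a * y + 1 * x) ≡ a * (x + y) + x
          regroup = solve-∀
  partialBinomial-suc a i (suc j) = begin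
      partialBinomial a (suc i) (suc j) + choose (suc i) (suc (suc j)) * a ^ (suc i ∸ suc (suc j))
        ≡⟨ cong₂ _+_ (partialBinomial-suc a i j) (choose-term-suc a i (suc j)) ⟩
      (a * B + partialBinomial a i j) + (a * (choose i (suc (suc j)) * a ^ (i ∸ suc (suc j))) + choose i (suc j) * a ^ (i ∸ suc j))
        ≡⟨ regroup a (partialBinomial a i j) (choose i (suc j) * a ^ (i ∸ suc j)) (choose i (suc (suc j)) * a ^ (i ∸ suc (suc j))) ⟩
      a * (B + choose i (suc (suc j)) * a ^ (i ∸ suc (suc j))) + B ∎
    where open ≡-Reasoning
          B = partialBinomial a i (suc j)
          regroup : ∀ a B t u → (a * (B + t) + B) + (a * u + t) ≡ a * ((B + t) + u) + (B + t)
          regroup = solve-∀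

  partialBinomial≤[1+a]^i : ∀ a i j → partialBinomial a i j ≤ suc a ^ i
  partialBinomial≤[1+a]^i a zero zero = ≤-refl
  partialBinomial≤[1+a]^i a zero (suc j) = ≤-trans (≤-reflexive (+-identityʳ _)) (partialBinomial≤[1+a]^i a zero j)
  partialBinomial≤[1+a]^i a (suc i) zero = ^-monoˡ-≤ (suc i) (n≤1+n a)
  partialBinomial≤[1+a]^i a (suc i) (suc j) = begin
    partialBinomial a (suc i) (suc j) ≡⟨ partialBinomial-suc a i j ⟩
    a * partialBinomial a i (suc j) + partialBinomial a i j
      ≤⟨ +-mono-≤ (*-monoʳ-≤ a (partialBinomial≤[1+a]^i a i (suc j))) (partialBinomial≤[1+a]^i a i j) ⟩
    a * suc a ^ i + suc a ^ i ≡⟨ +-comm (a * suc a ^ i) _ ⟩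
    suc a * suc a ^ i ∎
    where open ≤-Reasoning

-- e^(a+1) ≥ e · e^a, truncated: the Cauchy product of the series for e and e^a is
-- dominated termwise by the series for e^(a+1), by the binomial theorem.
module CauchyProduct where
  open import Data.Nat as ℕ using (ℕ; zero; suc; _!; _^_; _∸_)
  import Data.Nat.Properties as ℕP
  open import Data.Rational as Q using (ℚ; 0ℚ; 1ℚ; _+_; _*_; _≤_; _<_)
  import Data.Rational.Properties as QP
  open import Data.Rational.Solver using (module +-*-Solver)
  open import Relation.Binary.PropositionalEquality
  open import Data.Product using (_,_)
  open import Relation.Nullary using (yes; no)
  open NatEmbedding
  open ExpSeries
  open Binomial
  open +-*-Solver

  -- shiftedTerm x m b = x^(m-b)/(m-b)! and shiftedSum x N b = expSum x (N-b) for b ≤ m resp. b ≤ N;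
  -- both are 0 otherwise.
  shiftedTerm shiftedSum : ℚ → ℕ → ℕ → ℚ
  shiftedTerm x m zero = expTerm x m
  shiftedTerm x zero (suc b) = 0ℚ
  shiftedTerm x (suc m) (suc b) = shiftedTerm x m b
  shiftedSum x N zero = expSum x N
  shiftedSum x zero (suc b) = 0ℚ
  shiftedSum x (suc N) (suc b) = shiftedSum x N b

  weighted : ℕ → (ℕ → ℚ) → ℚ
  weighted zero F = expTerm 1ℚ 0 * F 0
  weighted (suc j) F = weighted j F + expTerm 1ℚ (suc j) * F (suc j)

  weighted-cong : ∀ j F G → (∀ b → F b ≡ G b) → weighted j F ≡ weighted j G
  weighted-cong zero F G F≗G = cong (expTerm 1ℚ 0 *_) (F≗G 0)
  weighted-cong (suc j) F G F≗G = cong₂ _+_ (weighted-cong j F G F≗G) (cong (expTerm 1ℚ (suc j) *_) (F≗G (suc j)))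

  weighted-+ : ∀ j F G → weighted j (λ b → F b + G b) ≡ weighted j F + weighted j G
  weighted-+ zero F G = QP.*-distribˡ-+ (expTerm 1ℚ 0) (F 0) (G 0)
  weighted-+ (suc j) F G = begin
      weighted j (λ b → F b + G b) + t * (F (suc j) + G (suc j)) ≡⟨ cong (_+ t * (F (suc j) + G (suc j))) (weighted-+ j F G) ⟩
      (weighted j F + weighted j G) + t * (F (suc j) + G (suc j))
        ≡⟨ solve 5 (λ a b t f g → (a :+ b) :+ t :* (f :+ g) := (a :+ t :* f) :+ (b :+ t :* g)) refl
                   (weighted j F) (weighted j G) t (F (suc j)) (G (suc j)) ⟩
      (weighted j F + t * F (suc j)) + (weighted j G + t * G (suc j)) ∎
    where
      open ≡-Reasoning
      t = expTerm 1ℚ (suc j)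

  weighted-mono : ∀ j F G → (∀ b → b ℕ.≤ j → F b ≤ G b) → weighted j F ≤ weighted j G
  weighted-mono zero F G F≤G = *-monoˡ-≤-0≤ _ (0≤expTerm 1ℚ 0 (QP.nonNegative⁻¹ 1ℚ)) (F≤G 0 ℕ.z≤n)
  weighted-mono (suc j) F G F≤G = QP.+-mono-≤ (weighted-mono j F G λ b b≤j → F≤G b (ℕP.m≤n⇒m≤1+n b≤j))
    (*-monoˡ-≤-0≤ _ (0≤expTerm 1ℚ (suc j) (QP.nonNegative⁻¹ 1ℚ)) (F≤G (suc j) ℕP.≤-refl))

  weighted-const : ∀ j c → weighted j (λ _ → c) ≡ expSum 1ℚ j * c
  weighted-const zero c = refl
  weighted-const (suc j) c = trans (cong (_+ expTerm 1ℚ (suc j) * c) (weighted-const j c))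
    (sym (QP.*-distribʳ-+ c (expSum 1ℚ j) (expTerm 1ℚ (suc j))))

  shiftedSum-suc : ∀ x N b → shiftedSum x (suc N) b ≡ shiftedSum x N b + shiftedTerm x (suc N) b
  shiftedSum-suc x N zero = refl
  shiftedSum-suc x zero (suc zero) = sym (QP.+-identityˡ _)
  shiftedSum-suc x zero (suc (suc b)) = refl
  shiftedSum-suc x (suc N) (suc b) = shiftedSum-suc x N b

  shiftedSum-+ : ∀ x b M → shiftedSum x (b ℕ.+ M) b ≡ expSum x M
  shiftedSum-+ x zero M = refl
  shiftedSum-+ x (suc b) M = shiftedSum-+ x b M

  shiftedTerm-+ : ∀ x b c → shiftedTerm x (b ℕ.+ c) b ≡ expTerm x c
  shiftedTerm-+ x zero c = refl
  shiftedTerm-+ x (suc b) c = shiftedTerm-+ x b c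

  shiftedTerm-< : ∀ x m b → m ℕ.< b → shiftedTerm x m b ≡ 0ℚ
  shiftedTerm-< x zero (suc b) _ = refl
  shiftedTerm-< x (suc m) (suc b) (ℕ.s≤s m<b) = shiftedTerm-< x m b m<b

  binomialTerm : ∀ a m b → expTerm 1ℚ b * shiftedTerm (ι a) m b * ι (m !) ≡ ι (choose m b ℕ.* a ^ (m ∸ b))
  binomialTerm a m b with b ℕ.≤? m
  ... | yes b≤m with ℕP.m≤n⇒∃[o]m+o≡n b≤m
  ... | c , refl = begin
      T1 * shiftedTerm (ι a) (b ℕ.+ c) b * ι ((b ℕ.+ c) !)
        ≡⟨ cong₂ (λ u v → T1 * u * v) (shiftedTerm-+ (ι a) b c) (cong ι (sym (choose*!*!≡! b c))) ⟩
      T1 * Ta * ι (B ℕ.* (b ! ℕ.* c !)) ≡⟨ cong (T1 * Ta *_) (trans (ι-* B (b ! ℕ.* c !)) (cong (ι B *_) (ι-* (b !) (c !)))) ⟩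
      T1 * Ta * (ι B * (ι (b !) * ι (c !)))
        ≡⟨ solve 5 (λ t1 ta β f g → t1 :* ta :* (β :* (f :* g)) := β :* (t1 :* f) :* (ta :* g)) refl T1 Ta (ι B) (ι (b !)) (ι (c !)) ⟩
      ι B * (T1 * ι (b !)) * (Ta * ι (c !)) ≡⟨ cong₂ (λ u v → ι B * u * v) (expTerm-ι 1 b) (expTerm-ι a c) ⟩
      ι B * ι (1 ^ b) * ι (a ^ c) ≡⟨ cong (λ u → ι B * ι u * ι (a ^ c)) (ℕP.^-zeroˡ b) ⟩
      ι B * ι 1 * ι (a ^ c) ≡⟨ cong (_* ι (a ^ c)) (QP.*-identityʳ (ι B)) ⟩
      ι B * ι (a ^ c) ≡⟨ ι-* B (a ^ c) ⟨
      ι (B ℕ.* a ^ c) ≡⟨ cong (λ u → ι (B ℕ.* a ^ u)) (ℕP.m+n∸m≡n b c) ⟨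
      ι (B ℕ.* a ^ ((b ℕ.+ c) ∸ b)) ∎
    where
      open ≡-Reasoning
      T1 = expTerm 1ℚ b
      Ta = expTerm (ι a) c
      B = choose (b ℕ.+ c) b
  binomialTerm a m b | no b≰m = begin
      expTerm 1ℚ b * shiftedTerm (ι a) m b * ι (m !) ≡⟨ cong (λ u → expTerm 1ℚ b * u * ι (m !)) (shiftedTerm-< (ι a) m b m<b) ⟩
      expTerm 1ℚ b * 0ℚ * ι (m !) ≡⟨ solve 2 (λ t f → t :* con 0ℚ :* f := con 0ℚ) refl (expTerm 1ℚ b) (ι (m !)) ⟩
      ι 0 ≡⟨ cong (λ u → ι (u ℕ.* a ^ (m ∸ b))) (choose-< m b m<b) ⟨
      ι (choose m b ℕ.* a ^ (m ∸ b)) ∎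
    where
      open ≡-Reasoning
      m<b = ℕP.≰⇒> b≰m

  weighted-shiftedTerm : ∀ a m j → weighted j (shiftedTerm (ι a) m) * ι (m !) ≡ ι (partialBinomial a m j)
  weighted-shiftedTerm a m zero = trans (binomialTerm a m 0) (cong ι (ℕP.*-identityˡ (a ^ m)))
  weighted-shiftedTerm a m (suc j) = begin
      (weighted j F + t * F (suc j)) * ι (m !) ≡⟨ QP.*-distribʳ-+ (ι (m !)) (weighted j F) (t * F (suc j)) ⟩
      weighted j F * ι (m !) + t * F (suc j) * ι (m !) ≡⟨ cong₂ _+_ (weighted-shiftedTerm a m j) (binomialTerm a m (suc j)) ⟩
      ι (partialBinomial a m j) + ι (choose m (suc j) ℕ.* a ^ (m ∸ suc j)) ≡⟨ ι-+ (partialBinomial a m j) _ ⟨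
      ι (partialBinomial a m (suc j)) ∎
    where
      open ≡-Reasoning
      F = shiftedTerm (ι a) m
      t = expTerm 1ℚ (suc j)

  weighted-shiftedTerm≤expTerm : ∀ a j m → weighted j (shiftedTerm (ι a) m) ≤ expTerm (ι (suc a)) m
  weighted-shiftedTerm≤expTerm a j m = *-cancelʳ-≤-0< (ι (m !)) (0<ι! m) (begin
      weighted j (shiftedTerm (ι a) m) * ι (m !) ≡⟨ weighted-shiftedTerm a m j ⟩
      ι (partialBinomial a m j) ≤⟨ ι-mono-≤ (partialBinomial≤[1+a]^i a m j) ⟩
      ι (suc a ^ m) ≡⟨ expTerm-ι (suc a) m ⟨
      expTerm (ι (suc a)) m * ι (m !) ∎)
    where open QP.≤-Reasoning

  weighted-shiftedSum≤expSum : ∀ a j N → weighted j (shiftedSum (ι a) N) ≤ expSum (ι (suc a)) N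
  weighted-shiftedSum≤expSum a j zero = QP.≤-reflexive (weighted-shiftedSum-zero j)
    where weighted-shiftedSum-zero : ∀ j → weighted j (shiftedSum (ι a) 0) ≡ 1ℚ
          weighted-shiftedSum-zero zero = refl
          weighted-shiftedSum-zero (suc j) =
            trans (cong₂ _+_ (weighted-shiftedSum-zero j) (QP.*-zeroʳ (expTerm 1ℚ (suc j)))) (QP.+-identityʳ 1ℚ)
  weighted-shiftedSum≤expSum a j (suc N) = begin
      weighted j (shiftedSum (ι a) (suc N))
        ≡⟨ weighted-cong j _ (λ b → shiftedSum (ι a) N b + shiftedTerm (ι a) (suc N) b) (shiftedSum-suc (ι a) N) ⟩
      weighted j (λ b → shiftedSum (ι a) N b + shiftedTerm (ι a) (suc N) b)
        ≡⟨ weighted-+ j (shiftedSum (ι a) N) (shiftedTerm (ι a) (suc N)) ⟩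
      weighted j (shiftedSum (ι a) N) + weighted j (shiftedTerm (ι a) (suc N))
        ≤⟨ QP.+-mono-≤ (weighted-shiftedSum≤expSum a j N) (weighted-shiftedTerm≤expTerm a j (suc N)) ⟩
      expSum (ι (suc a)) N + expTerm (ι (suc a)) (suc N) ∎
    where open QP.≤-Reasoning

  expSum1*expSum≤expSum-suc : ∀ a j N → expSum 1ℚ j * expSum (ι a) N ≤ expSum (ι (suc a)) (j ℕ.+ N)
  expSum1*expSum≤expSum-suc a j N = begin
      expSum 1ℚ j * expSum (ι a) N ≡⟨ weighted-const j (expSum (ι a) N) ⟨
      weighted j (λ _ → expSum (ι a) N) ≤⟨ weighted-mono j (λ _ → expSum (ι a) N) (shiftedSum (ι a) (j ℕ.+ N)) pointwise ⟩
      weighted j (shiftedSum (ι a) (j ℕ.+ N)) ≤⟨ weighted-shiftedSum≤expSum a j (j ℕ.+ N) ⟩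
      expSum (ι (suc a)) (j ℕ.+ N) ∎
    where
      open QP.≤-Reasoning
      pointwise : ∀ b → b ℕ.≤ j → expSum (ι a) N ≤ shiftedSum (ι a) (j ℕ.+ N) b
      pointwise b b≤j = subst (λ z → expSum (ι a) N ≤ shiftedSum (ι a) z b) b+[[j∸b]+N]≡j+N
        (subst (expSum (ι a) N ≤_) (sym (shiftedSum-+ (ι a) b ((j ∸ b) ℕ.+ N))) (expSum-monoʳ (ι a) (0≤ι a) (ℕP.m≤n+m N (j ∸ b))))
        where b+[[j∸b]+N]≡j+N : b ℕ.+ ((j ∸ b) ℕ.+ N) ≡ j ℕ.+ N
              b+[[j∸b]+N]≡j+N = trans (sym (ℕP.+-assoc b (j ∸ b) N)) (cong (ℕ._+ N) (ℕP.m+[n∸m]≡n b≤j))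

module RationalBounds where
  open import Data.Nat as ℕ using (ℕ; zero; suc; _!; _^_)
  import Data.Nat.Properties as ℕP
  open import Data.Nat.DivMod using (_/_; m≡m%n+[m/n]*n; m%n<n)
  open import Data.Rational as Q using (0ℚ; 1ℚ; _+_; _*_; _-_; _≤_; _<_)
  import Data.Rational.Properties as QP
  open import Data.Rational.Solver using (module +-*-Solver)
  open import Relation.Binary.PropositionalEquality
  open import Relation.Nullary using (yes; no)
  open import Data.Empty using (⊥; ⊥-elim)
  open import Data.Product using (_,_)
  open import Data.Nat.Tactic.RingSolver using (solve-∀)
  open NatEmbedding
  open ExpSeries
  open CauchyProduct using (expSum1*expSum≤expSum-suc)
  open NumericBounds using (A₁; A₂)
  open +-*-Solver

  weaken-relative-bound : ∀ z Y K D → 0ℚ ≤ K → ι D ≤ Y → z * Y < (Y + 1ℚ) * K → ι D * z ≤ (ι D + 1ℚ) * K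
  weaken-relative-bound z Y K D 0≤K D≤Y zY<[Y+1]K with ι D * z QP.≤? (ι D + 1ℚ) * K
  ... | yes Dz≤[D+1]K = Dz≤[D+1]K
  ... | no Dz≰[D+1]K = ⊥-elim (QP.<-irrefl refl (QP.<-trans [Y+1]K<zY zY<[Y+1]K))
    where
      w = z - K
      z≡K+w : z ≡ K + w
      z≡K+w = solve 2 (λ z K → z := K :+ (z :- K)) refl z K
      K<Dw : K < ι D * w
      K<Dw with ι D * w QP.≤? K
      ... | no Dw≰K = QP.≰⇒> Dw≰K
      ... | yes Dw≤K = ⊥-elim (Dz≰[D+1]K (subst₂ _≤_
            (trans (sym (QP.*-distribˡ-+ (ι D) K w)) (cong (ι D *_) (sym z≡K+w)))
            (solve 2 (λ D K → D :* K :+ K := (D :+ con 1ℚ) :* K) refl (ι D) K)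
            (QP.+-monoʳ-≤ (ι D * K) Dw≤K)))
      0≤w : 0ℚ ≤ w
      0≤w with 0ℚ QP.≤? w
      ... | yes 0≤w = 0≤w
      ... | no 0≰w = ⊥-elim (QP.<-irrefl refl (QP.<-≤-trans K<Dw (QP.≤-trans
            (subst (ι D * w ≤_) (QP.*-zeroʳ (ι D)) (*-monoˡ-≤-0≤ (ι D) (0≤ι D) (QP.<⇒≤ (QP.≰⇒> 0≰w)))) 0≤K)))
      [Y+1]K<zY : (Y + 1ℚ) * K < z * Y
      [Y+1]K<zY = subst₂ _<_
        (solve 2 (λ Y K → Y :* K :+ K := (Y :+ con 1ℚ) :* K) refl Y K)
        (solve 3 (λ z Y K → Y :* K :+ Y :* (z :- K) := z :* Y) refl z Y K)
        (QP.+-monoʳ-< (Y * K) (QP.<-≤-trans K<Dw (*-monoʳ-≤-0≤ w 0≤w D≤Y)))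

  -- 163/60 ≤ Σ_{i ≤ 5} 1/i! ≤ e
  ι60*expSum1-5 : ι 60 * expSum 1ℚ 5 ≡ ι 163
  ι60*expSum1-5 = refl

  expSum600-3 : expSum (ι 600) 3 ≡ ι 36180601
  expSum600-3 = refl

  ι10⁷*[ιn*expSum1-5]*ι60≡ι[A₁*n] : ∀ n → ι 10000000 * (ι n * expSum 1ℚ 5) * ι 60 ≡ ι (A₁ ℕ.* n)
  ι10⁷*[ιn*expSum1-5]*ι60≡ι[A₁*n] n = begin
    ι 10000000 * (ι n * expSum 1ℚ 5) * ι 60
      ≡⟨ solve 4 (λ a b c d → a :* (b :* c) :* d := a :* b :* (d :* c)) refl (ι 10000000) (ι n) (expSum 1ℚ 5) (ι 60) ⟩
    ι 10000000 * ι n * (ι 60 * expSum 1ℚ 5) ≡⟨ cong (ι 10000000 * ι n *_) ι60*expSum1-5 ⟩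
    ι 10000000 * ι n * ι 163 ≡⟨ cong (_* ι 163) (ι-* 10000000 n) ⟨
    ι (10000000 ℕ.* n) * ι 163 ≡⟨ ι-* (10000000 ℕ.* n) 163 ⟨
    ι (10000000 ℕ.* n ℕ.* 163) ≡⟨ cong ι (evaluate n) ⟩
    ι (A₁ ℕ.* n) ∎
    where open ≡-Reasoning
          evaluate : ∀ n → 10000000 ℕ.* n ℕ.* 163 ≡ 1630000000 ℕ.* n
          evaluate = solve-∀

  [ι10⁷+1]*ι[K]*ι60≡ι[A₂*K] : ∀ K → (ι 10000000 + 1ℚ) * ι K * ι 60 ≡ ι (A₂ ℕ.* K)
  [ι10⁷+1]*ι[K]*ι60≡ι[A₂*K] K = begin
    (ι 10000000 + 1ℚ) * ι K * ι 60 ≡⟨ cong (λ u → u * ι K * ι 60) (ι-+ 10000000 1) ⟨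
    ι 10000001 * ι K * ι 60 ≡⟨ cong (_* ι 60) (ι-* 10000001 K) ⟨
    ι (10000001 ℕ.* K) * ι 60 ≡⟨ ι-* (10000001 ℕ.* K) 60 ⟨
    ι (10000001 ℕ.* K ℕ.* 60) ≡⟨ cong ι (evaluate K) ⟩
    ι (A₂ ℕ.* K) ∎
    where open ≡-Reasoning
          evaluate : ∀ x → 10000001 ℕ.* x ℕ.* 60 ≡ 600000060 ℕ.* x
          evaluate = solve-∀

  -- n e^{601} < (e^{600} + 1) k² with e^{601} ≥ (163/60) e^{600} and e^{600} ≥ 10⁷.
  lengthBound⇒A₁n≤A₂k² : ∀ n k → LengthBound n k → A₁ ℕ.* n ℕ.≤ A₂ ℕ.* (k ℕ.* k)
  lengthBound⇒A₁n≤A₂k² n k (q , ne⁶⁰¹≤q , (N₀ , q<[e⁶⁰⁰+1]k²)) =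
    ι-cancel-≤ (subst₂ _≤_ (ι10⁷*[ιn*expSum1-5]*ι60≡ι[A₁*n] n) ([ι10⁷+1]*ι[K]*ι60≡ι[A₂*K] (k ℕ.* k)) bound)
    where
      N = N₀ ℕ.+ 3
      Y = expSum (ι 600) N
      K = ι (k ℕ.* k)
      z = ι n * expSum 1ℚ 5
      10⁷≤Y : ι 10000000 ≤ Y
      10⁷≤Y = QP.≤-trans (ι-mono-≤ (ℕP.m≤m+n 10000000 26180601))
        (QP.≤-trans (QP.≤-reflexive (sym expSum600-3)) (expSum-monoʳ (ι 600) (0≤ι 600) (ℕP.m≤n+m 3 N₀)))
      zY<[Y+1]K : z * Y < (Y + 1ℚ) * K
      zY<[Y+1]K = QP.≤-<-trans
        (QP.≤-trans (QP.≤-reflexive (QP.*-assoc (ι n) (expSum 1ℚ 5) Y))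
          (QP.≤-trans (*-monoˡ-≤-0≤ (ι n) (0≤ι n) (expSum1*expSum≤expSum-suc 600 5 N))
            (subst₂ (λ u v → u * expSum v (5 ℕ.+ N) ≤ q) (ι≡ℕtoℚ n) (ι≡ℕtoℚ 601) (ne⁶⁰¹≤q (5 ℕ.+ N)))))
        (QP.<-≤-trans (subst₂ (λ u v → q < (expSum u N₀ + 1ℚ) * v) (ι≡ℕtoℚ 600) (ι≡ℕtoℚ (k ℕ.* k)) q<[e⁶⁰⁰+1]k²)
          (*-monoʳ-≤-0≤ K (0≤ι (k ℕ.* k)) (QP.+-monoˡ-≤ 1ℚ (expSum-monoʳ (ι 600) (0≤ι 600) (ℕP.m≤m+n N₀ 3)))))
      bound : ι 10000000 * z * ι 60 ≤ (ι 10000000 + 1ℚ) * K * ι 60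
      bound = *-monoʳ-≤-0≤ (ι 60) (0≤ι 60) (weaken-relative-bound z Y K 10000000 (0≤ι _) 10⁷≤Y zY<[Y+1]K)

  k<[1+k/10⁴]*10⁴ : ∀ k → k ℕ.< suc (k / 10000) ℕ.* 10000
  k<[1+k/10⁴]*10⁴ k = subst (ℕ._< suc (k / 10000) ℕ.* 10000) (sym (m≡m%n+[m/n]*n k 10000))
    (ℕP.+-monoˡ-< ((k / 10000) ℕ.* 10000) (m%n<n k 10000))

  -- r e^{600} < k with e^{600} > 36180601 forces r < k/10⁴.
  r*36180601<k⇒k/10⁴≮r : ∀ r k R → r * ι 36180601 < ι k → k ℕ.< R ℕ.* 10000 → ι R < r → ⊥
  r*36180601<k⇒k/10⁴≮r r k R rD<k k<10⁴R R<r = ℕP.<-irrefl refl (ℕP.<-trans k<10⁴R (ℕP.≤-<-trans 10⁴R≤DR DR<k))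
    where
      10⁴R≤DR : R ℕ.* 10000 ℕ.≤ R ℕ.* 36180601
      10⁴R≤DR = ℕP.*-monoʳ-≤ R (ℕP.m≤m+n 10000 36170601)
      DR<k : R ℕ.* 36180601 ℕ.< k
      DR<k = ι-cancel-< (subst (_< ι k) (sym (ι-* R 36180601)) (QP.≤-<-trans (*-monoʳ-≤-0≤ (ι 36180601) (0≤ι _) (QP.<⇒≤ R<r)) rD<k))

  belowDeltaK⇒≤ : ∀ r k → BelowDeltaK r k → r ≤ ι (suc (k / 10000))
  belowDeltaK⇒≤ r k (q , q<k , re⁶⁰⁰≤q) with r QP.≤? ι (suc (k / 10000))
  ... | yes r≤R = r≤R
  ... | no r≰R = ⊥-elim (r*36180601<k⇒k/10⁴≮r r k (suc (k / 10000)) rD<k (k<[1+k/10⁴]*10⁴ k) (QP.≰⇒> r≰R))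
    where
      rD≤q : r * ι 36180601 ≤ q
      rD≤q = subst (λ u → r * u ≤ q) (trans (cong (λ v → expSum v 3) (ι≡ℕtoℚ 600)) expSum600-3) (re⁶⁰⁰≤q 3)
      rD<k : r * ι 36180601 < ι k
      rD<k = QP.≤-<-trans rD≤q (subst (q <_) (ι≡ℕtoℚ k) q<k)

  -- x^i/i! ≤ 2^{-i} (4624/625)^R for x = R, summed: e^R ≤ 2 (4624/625)^R.
  expTerm*625^R*2^i≤4624^R : ∀ R i → expTerm (ι R) i * ι (625 ^ R) * ι (2 ^ i) ≤ ι (4624 ^ R)
  expTerm*625^R*2^i≤4624^R R i = *-cancelʳ-≤-0< (ι (i !)) (0<ι! i) (begin
      T * C * ι (2 ^ i) * ι (i !) ≡⟨ solve 4 (λ t c p f → t :* c :* p :* f := t :* f :* c :* p) refl T C (ι (2 ^ i)) (ι (i !)) ⟩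
      T * ι (i !) * C * ι (2 ^ i) ≡⟨ cong (λ u → u * C * ι (2 ^ i)) (expTerm-ι R i) ⟩
      ι (R ^ i) * C * ι (2 ^ i) ≡⟨ cong (_* ι (2 ^ i)) (ι-* (R ^ i) (625 ^ R)) ⟨
      ι (R ^ i ℕ.* 625 ^ R) * ι (2 ^ i) ≡⟨ ι-* (R ^ i ℕ.* 625 ^ R) (2 ^ i) ⟨
      ι (R ^ i ℕ.* 625 ^ R ℕ.* 2 ^ i) ≤⟨ ι-mono-≤ (EulerBounds.R^i*625^R*2^i≤4624^R*i! R i) ⟩
      ι (4624 ^ R ℕ.* i !) ≡⟨ ι-* (4624 ^ R) (i !) ⟩
      ι (4624 ^ R) * ι (i !) ∎)
    where
      open QP.≤-Reasoning
      T = expTerm (ι R) i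
      C = ι (625 ^ R)

  expSum*625^R*2^M+4624^R≤2*4624^R*2^M : ∀ R M →
    expSum (ι R) M * ι (625 ^ R) * ι (2 ^ M) + ι (4624 ^ R) ≤ ι 2 * ι (4624 ^ R) * ι (2 ^ M)
  expSum*625^R*2^M+4624^R≤2*4624^R*2^M R zero = begin
      1ℚ * C * 1ℚ + A ≡⟨ solve 2 (λ c a → con 1ℚ :* c :* con 1ℚ :+ a := c :+ a) refl C A ⟩
      C + A ≤⟨ QP.+-monoˡ-≤ A (ι-mono-≤ (ℕP.^-monoˡ-≤ R (ℕP.m≤m+n 625 3999))) ⟩
      A + A ≡⟨ solve 1 (λ a → a :+ a := (con 1ℚ :+ con 1ℚ) :* a :* con 1ℚ) refl A ⟩
      (1ℚ + 1ℚ) * A * 1ℚ ≡⟨ cong (λ u → u * A * 1ℚ) (ι-+ 1 1) ⟨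
      ι 2 * A * 1ℚ ∎
    where
      open QP.≤-Reasoning
      C = ι (625 ^ R)
      A = ι (4624 ^ R)
  expSum*625^R*2^M+4624^R≤2*4624^R*2^M R (suc M) = begin
      (E + T) * C * ι (2 ℕ.* 2 ^ M) + A ≡⟨ cong (λ u → (E + T) * C * u + A) (ι-* 2 (2 ^ M)) ⟩
      (E + T) * C * (ι 2 * P) + A
        ≡⟨ solve 6 (λ e t c two p a → (e :+ t) :* c :* (two :* p) :+ a := two :* (e :* c :* p) :+ (t :* c :* (two :* p) :+ a))
                   refl E T C (ι 2) P A ⟩
      ι 2 * (E * C * P) + (T * C * (ι 2 * P) + A)
        ≤⟨ QP.+-monoʳ-≤ (ι 2 * (E * C * P)) (QP.+-monoˡ-≤ A (subst (λ u → T * C * u ≤ A) (ι-* 2 (2 ^ M)) (expTerm*625^R*2^i≤4624^R R (suc M)))) ⟩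
      ι 2 * (E * C * P) + (A + A) ≡⟨ cong (λ u → u * (E * C * P) + (A + A)) (ι-+ 1 1) ⟩
      (1ℚ + 1ℚ) * (E * C * P) + (A + A)
        ≡⟨ solve 2 (λ x a → (con 1ℚ :+ con 1ℚ) :* x :+ (a :+ a) := (con 1ℚ :+ con 1ℚ) :* (x :+ a)) refl (E * C * P) A ⟩
      (1ℚ + 1ℚ) * (E * C * P + A) ≡⟨ cong (λ u → u * (E * C * P + A)) (ι-+ 1 1) ⟨
      ι 2 * (E * C * P + A) ≤⟨ *-monoˡ-≤-0≤ (ι 2) (0≤ι 2) (expSum*625^R*2^M+4624^R≤2*4624^R*2^M R M) ⟩
      ι 2 * (ι 2 * A * P) ≡⟨ solve 3 (λ two a p → two :* (two :* a :* p) := two :* a :* (two :* p)) refl (ι 2) A P ⟩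
      ι 2 * A * (ι 2 * P) ≡⟨ cong (ι 2 * A *_) (ι-* 2 (2 ^ M)) ⟨
      ι 2 * A * ι (2 ℕ.* 2 ^ M) ∎
    where
      open QP.≤-Reasoning
      E = expSum (ι R) M
      T = expTerm (ι R) (suc M)
      C = ι (625 ^ R)
      A = ι (4624 ^ R)
      P = ι (2 ^ M)

  expSum*625^R≤2*4624^R : ∀ R M → expSum (ι R) M * ι (625 ^ R) ≤ ι 2 * ι (4624 ^ R)
  expSum*625^R≤2*4624^R R M = *-cancelʳ-≤-0< (ι (2 ^ M)) (ι-mono-< (ℕP.m^n>0 2 M)) (QP.≤-trans
    (subst (_≤ expSum (ι R) M * ι (625 ^ R) * ι (2 ^ M) + ι (4624 ^ R)) (QP.+-identityʳ _)
      (QP.+-monoʳ-≤ (expSum (ι R) M * ι (625 ^ R) * ι (2 ^ M)) (0≤ι (4624 ^ R))))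
    (expSum*625^R*2^M+4624^R≤2*4624^R*2^M R M))

  patternBound-ℕ⇒ℚ : ∀ P R k r M → 0ℚ ≤ r → r ≤ ι R → P ℕ.* 2 ℕ.* 4624 ^ R ℕ.≤ k ! ℕ.* 625 ^ R →
    ℕtoℚ P * expSum r M ≤ ℕtoℚ (k !)
  patternBound-ℕ⇒ℚ P R k r M 0≤r r≤R bound = subst₂ _≤_ (cong (_* expSum r M) (sym (ι≡ℕtoℚ P))) (sym (ι≡ℕtoℚ (k !)))
    (*-cancelʳ-≤-0< C (ι-mono-< (ℕP.m^n>0 625 R)) (begin
      ι P * expSum r M * C ≤⟨ *-monoʳ-≤-0≤ C (0≤ι _) (*-monoˡ-≤-0≤ (ι P) (0≤ι P) (expSum-monoˡ M 0≤r r≤R)) ⟩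
      ι P * expSum (ι R) M * C ≡⟨ QP.*-assoc (ι P) (expSum (ι R) M) C ⟩
      ι P * (expSum (ι R) M * C) ≤⟨ *-monoˡ-≤-0≤ (ι P) (0≤ι P) (expSum*625^R≤2*4624^R R M) ⟩
      ι P * (ι 2 * ι (4624 ^ R)) ≡⟨ cong (ι P *_) (ι-* 2 (4624 ^ R)) ⟨
      ι P * ι (2 ℕ.* 4624 ^ R) ≡⟨ ι-* P (2 ℕ.* 4624 ^ R) ⟨
      ι (P ℕ.* (2 ℕ.* 4624 ^ R)) ≡⟨ cong ι (ℕP.*-assoc P 2 (4624 ^ R)) ⟨
      ι (P ℕ.* 2 ℕ.* 4624 ^ R) ≤⟨ ι-mono-≤ bound ⟩
      ι (k ! ℕ.* 625 ^ R) ≡⟨ ι-* (k !) (625 ^ R) ⟩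
      ι (k !) * C ∎))
    where
      open QP.≤-Reasoning
      C = ι (625 ^ R)

open import Data.Nat using (ℕ; _≤_; _*_; _^_; _!)
open import Data.Fin using (Fin)
open import Data.Vec using (Vec; toList)
open import Data.Product using (∃; _,_; uncurry)
open import Data.Sum using (_⊎_; inj₁; inj₂)
import Data.Nat as ℕ
import Data.Nat.Properties as ℕP
open import Data.Nat.DivMod using (_/_; m/n*n≤m)
open import Data.List using (length)
import Data.List.Relation.Unary.All as All
open import Relation.Nullary using (yes; no)
open import Function using (case_of_)
open import Relation.Binary.PropositionalEquality
open NumericBounds using (P*2*4624^[1+R]≤k!*625^[1+R])
open Arrangements using (∏; occurrences)
open Patterns using (#patterns≤∏occurrences; containedPerm)
open SymbolCounts using (numRare; numCommon+numRare≡k; c^c*10^d*∏occurrences≤n^c*k^d)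
open RationalBounds using (lengthBound⇒A₁n≤A₂k²; belowDeltaK⇒≤; patternBound-ℕ⇒ℚ)

100*c<99*k⇒k≤100*d : ∀ k c d → c ℕ.+ d ≡ k → 100 * c ℕ.< 99 * k → k ≤ 100 * d
100*c<99*k⇒k≤100*d k c d c+d≡k 100c<99k = ℕP.<⇒≤ (ℕP.+-cancelˡ-< (100 * c) k (100 * d) (begin-strict
  100 * c ℕ.+ k <⟨ ℕP.+-monoˡ-< k 100c<99k ⟩
  99 * k ℕ.+ k ≡⟨ ℕP.+-comm (99 * k) k ⟩
  100 * k ≡⟨ cong (100 *_) c+d≡k ⟨
  100 * (c ℕ.+ d) ≡⟨ ℕP.*-distribˡ-+ 100 c d ⟩
  100 * c ℕ.+ 100 * d ∎))
  where open ℕP.≤-Reasoning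

fewCommon⇒fewPatterns : ∀ k → 100000 ≤ k → ∀ n (σ : Vec (Fin k) n) → LengthBound n k →
  100 * numCommon σ ℕ.< 99 * k → FewPatterns σ
fewCommon⇒fewPatterns k 100000≤k n σ lengthBound fewCommon πs unique contained r 0≤r below M =
  patternBound-ℕ⇒ℚ (length πs) (ℕ.suc R) k r M 0≤r (belowDeltaK⇒≤ r k below) #patterns-bound
  where
    R : ℕ
    R = k / 10000
    manyRare : k ≤ 100 * numRare σ
    manyRare = 100*c<99*k⇒k≤100*d k (numCommon σ) (numRare σ) (numCommon+numRare≡k σ) fewCommon
    10000R≤k : 10000 * R ≤ k
    10000R≤k = subst (_≤ k) (ℕP.*-comm R 10000) (m/n*n≤m k 10000)
    #patterns≤∏ : length πs ≤ ∏ (occurrences (toList σ))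
    #patterns≤∏ = #patterns≤∏occurrences σ πs unique (All.map (uncurry containedPerm) contained)
    #patterns-bound : length πs * 2 * 4624 ^ ℕ.suc R ≤ k ! * 625 ^ ℕ.suc R
    #patterns-bound = P*2*4624^[1+R]≤k!*625^[1+R] k (numCommon σ) (numRare σ) n (∏ (occurrences (toList σ))) (length πs) R
          (numCommon+numRare≡k σ) manyRare 10000R≤k 100000≤k
          (c^c*10^d*∏occurrences≤n^c*k^d σ) (lengthBound⇒A₁n≤A₂k² n k lengthBound) #patterns≤∏

lemma5p1 : ∃ λ K → (k : ℕ) → K ≤ k → (n : ℕ) → (σ : Vec (Fin k) n) →
    LengthBound n k →
    FewPatterns σ ⊎ 99 * k ≤ 100 * numCommon σ
lemma5p1 = 100000 , λ k 100000≤k n σ lengthBound → case 99 * k ℕ.≤? 100 * numCommon σ of λ where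
  (yes manyCommon) → inj₂ manyCommon
  (no ¬manyCommon) → inj₁ (fewCommon⇒fewPatterns k 100000≤k n σ lengthBound (ℕP.≰⇒> ¬manyCommon))
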